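{- Let $\mathbb{F}$ be a field and let $f(\vec x),g(\vec x)\in\mathbb{F}[\vec x]$. Suppose $f(\vec x)+O(\varepsilon)$ can be computed by a circuit of size $s$ with $g$-oracle gates. Let $h(\vec x,\delta)\in\mathbb{F}[[\delta]][\vec x]$ satisfy $h(\vec x,\delta)=g(\vec x)+O(\delta)$. Then there is some $N\in\mathbb{N}$ such that $f(\vec x)+O(\varepsilon)$ can be computed by a circuit of size $s$ with $h(\vec x,\varepsilon^N)$-oracle gates.
   Context: $\varepsilon,\delta$ are indeterminates. "$f+O(\varepsilon)$" denotes a polynomial $f+\varepsilon g'$ with $g'\in\mathbb{F}[[\varepsilon]][\vec x]$ (similarly for $\delta$); a circuit computing $f+O(\varepsilon)$ is a circuit with constants from $\mathbb{F}((\varepsilon))$ computing such a polynomial. A $g$-oracle circuit may additionally use gates which, on inputs $a_1,\dots,a_N$, output $g(a_1,\dots,a_N)$. -}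

module Defs where

open import Level using (Level; _⊔_)
open import Algebra.Bundles using (CommutativeRing)
open import Data.Nat using (ℕ; zero; suc; _∸_; _<ᵇ_; _≡ᵇ_; _≤_) renaming (_+_ to _+ℕ_; _*_ to _*ℕ_)
open import Data.Integer using (ℤ; +_; -[1+_])
open import Data.Bool using (Bool; true; false; if_then_else_; _∧_)
open import Data.Fin using (Fin; zero; suc)
open import Data.Vec using (Vec; []; _∷_)
open import Data.List using (List; []; _∷_; map; concatMap; foldr; upTo)
open import Data.Product using (_×_; _,_; Σ)
open import Relation.Nullary using (¬_)

record Field (c ℓ : Level) : Set (Level.suc (c ⊔ ℓ)) where
  field
    commutativeRing : CommutativeRing c ℓ
  open CommutativeRing commutativeRing public
  field
    0≉1 : ¬ (0# ≈ 1#)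
    inverse : ∀ x → ¬ (x ≈ 0#) → Σ Carrier (λ y → (x * y) ≈ 1#)

-- Polynomial expressions in n variables with constants from A.
-- A polynomial in A[x₁,…,xₙ] is given by any expression denoting it;
-- all statements below only depend on its coefficients.

data Expr {a : Level} (A : Set a) (n : ℕ) : Set a where
  var  : Fin n → Expr A n
  con  : A → Expr A n
  _⊕_  : Expr A n → Expr A n → Expr A n
  _⊗_  : Expr A n → Expr A n → Expr A n

Monomial : ℕ → Set
Monomial n = Vec ℕ n

allZero : ∀ {n} → Monomial n → Bool
allZero []      = true
allZero (a ∷ m) = (a ≡ᵇ 0) ∧ allZero m

isUnit : ∀ {n} → Fin n → Monomial n → Bool
isUnit zero    (a ∷ m) = (a ≡ᵇ 1) ∧ allZero m
isUnit (suc i) (a ∷ m) = (a ≡ᵇ 0) ∧ isUnit i m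

-- all pairs (u , v) with u + v = m (componentwise)
splits : ∀ {n} → Monomial n → List (Monomial n × Monomial n)
splits []      = ([] , []) ∷ []
splits (a ∷ m) = concatMap (λ k → map (λ uv → (k ∷ Data.Product.proj₁ uv , (a ∸ k) ∷ Data.Product.proj₂ uv)) (splits m)) (upTo (suc a))

module WithField {c ℓ : Level} (F : Field c ℓ) where
  open Field F

  sumF : List Carrier → Carrier
  sumF = foldr _+_ 0#

  Series : Set c
  Series = ℕ → Carrier

  -- Laurent series in F((ε)): ε^(-lsh) · Σ_i lco i ε^i.
  record Laurent : Set c where
    constructor laurent
    field
      lsh : ℕ
      lco : ℕ → Carrier

  -- Elements of F((ε))[x₁,…,xₙ]:  Σ_{m,i} co m i · ε^(i - sh) · x^m.
  record LPoly (n : ℕ) : Set c where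
    constructor lpoly
    field
      sh : ℕ
      co : Monomial n → ℕ → Carrier
  open LPoly public

  -- coefficient of ε^d x^m, d ∈ ℤ
  coeffAt : ∀ {n} → LPoly n → Monomial n → ℤ → Carrier
  coeffAt p m (+ k)    = co p m (k +ℕ sh p)
  coeffAt p m -[1+ k ] = if k <ᵇ sh p then co p m (sh p ∸ suc k) else 0#

  addP : ∀ {n} → LPoly n → LPoly n → LPoly n
  addP p q = lpoly (sh p +ℕ sh q) (λ m i →
      (if i <ᵇ sh q then 0# else co p m (i ∸ sh q))
    + (if i <ᵇ sh p then 0# else co q m (i ∸ sh p)))

  mulP : ∀ {n} → LPoly n → LPoly n → LPoly n
  mulP p q = lpoly (sh p +ℕ sh q) (λ m i →
    sumF (concatMap (λ uv → map (λ j → co p (Data.Product.proj₁ uv) j * co q (Data.Product.proj₂ uv) (i ∸ j)) (upTo (suc i))) (splits m)))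

  varP : ∀ {n} → Fin n → LPoly n
  varP x = lpoly 0 (λ { m zero → if isUnit x m then 1# else 0# ; m (suc _) → 0# })

  constP : ∀ {n} → Laurent → LPoly n
  constP l = lpoly (Laurent.lsh l) (λ m i → if allZero m then Laurent.lco l i else 0#)

  fromF : Carrier → Laurent
  fromF a = laurent 0 (λ { zero → a ; (suc _) → 0# })

  fromSeries : Series → Laurent
  fromSeries s = laurent 0 s

  -- substitution δ ↦ ε^N in a power series (meaningful for N ≥ 1)
  substPow : ℕ → Series → Series
  substPow N s i = sumF (map (λ k → if (N *ℕ k) ≡ᵇ i then s k else 0#) (upTo (suc i)))

  evalE : ∀ {a} {A : Set a} {k n} → (A → Laurent) → (Fin k → LPoly n) → Expr A k → LPoly n
  evalE emb ρ (var i) = ρ i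
  evalE emb ρ (con a) = constP (emb a)
  evalE emb ρ (e ⊕ e′) = addP (evalE emb ρ e) (evalE emb ρ e′)
  evalE emb ρ (e ⊗ e′) = mulP (evalE emb ρ e) (evalE emb ρ e′)

  -- Polynomials in F[x] and F[[δ]][x] as elements of F((ε))[x]
  ⟦_⟧F : ∀ {n} → Expr Carrier n → LPoly n
  ⟦ e ⟧F = evalE fromF varP e

  ⟦_⟧S : ∀ {n} → Expr Series n → LPoly n
  ⟦ e ⟧S = evalE fromSeries varP e

  -- "p = f + O(ε)": p = f + ε g′ with g′ ∈ F[[ε]][x]
  _≈f+O[ε] : ∀ {n} → LPoly n → Expr Carrier n → Set ℓ
  (p ≈f+O[ε]) f = ∀ m → (∀ k → coeffAt p m -[1+ k ] ≈ 0#)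
                        × (coeffAt p m (+ 0) ≈ coeffAt ⟦ f ⟧F m (+ 0))

  -- Oracle circuits over F((ε)) in n inputs x₁..xₙ, as straight-line
  -- programs.
  -- Oracle gates have n inputs (the oracle polynomial is in n variables).
  data Gate (n w : ℕ) : Set c where
    constG  : Laurent → Gate n w
    addG    : Fin w → Fin w → Gate n w
    mulG    : Fin w → Fin w → Gate n w
    oracleG : (Fin n → Fin w) → Gate n w

  -- Prog n k : a program with exactly k gates; wires are Fin (k + n)
  data Prog (n : ℕ) : ℕ → Set c where
    []  : Prog n 0
    _▷_ : ∀ {k} → Prog n k → Gate n (k +ℕ n) → Prog n (suc k)

  record Circuit (n s : ℕ) : Set c where
    constructor circuit
    field
      prog   : Prog n s
      output : Fin (s +ℕ n)

  Oracle : ℕ → Set c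
  Oracle n = (Fin n → LPoly n) → LPoly n

  evalGate : ∀ {n w} → Oracle n → (Fin w → LPoly n) → Gate n w → LPoly n
  evalGate O v (constG a)  = constP a
  evalGate O v (addG i j)  = addP (v i) (v j)
  evalGate O v (mulG i j)  = mulP (v i) (v j)
  evalGate O v (oracleG σ) = O (λ t → v (σ t))

  wires : ∀ {n k} → Oracle n → Prog n k → Fin (k +ℕ n) → LPoly n
  wires O []      i       = varP i
  wires O (P ▷ g) zero    = evalGate O (wires O P) g
  wires O (P ▷ g) (suc i) = wires O P i

  run : ∀ {n s} → Oracle n → Circuit n s → LPoly n
  run O C = wires O (Circuit.prog C) (Circuit.output C)

  oracleF : ∀ {n} → Expr Carrier n → Oracle n
  oracleF g ρ = evalE fromF ρ g

  oracleSubst : ∀ {n} → Expr Series n → ℕ → Oracle n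
  oracleSubst h N ρ = evalE (λ s → fromSeries (substPow N s)) ρ h

-- Replacing every g-oracle gate by an h(x, ε^N)-oracle gate perturbs the circuit only in
-- high powers of ε.  Since h(x, 0) and g have the same coefficients, they agree as functions
-- on F((ε))[x], and h(x, ε^N) ≡ h(x, 0) modulo ε^N.  Each wire of the circuit is a Laurent
-- polynomial whose pole in ε has order bounded in terms of the circuit alone, and a gate
-- multiplying by such a wire loses only that many powers of ε of precision.  Hence, once N
-- exceeds the total loss of precision along the circuit, the new output agrees with the old
-- one modulo ε, so it still computes f + O(ε).

module Submission where

open import Defs
open import Level using (Level)
open import Data.Nat using (ℕ; _≤_)
open import Data.Product using (Σ; _×_)

open import Level using (_⊔_)
open import Algebra.Bundles using (CommutativeRing; RawRing)
open import Algebra.Core using (Op₁; Op₂)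
open import Algebra.Morphism.Structures using (IsRingMonomorphism)
import Algebra.Morphism.RingMonomorphism as RingMonomorphism
import Algebra.Properties.CommutativeSemigroup as CommutativeSemigroupProperties
open import Algebra.Solver.Ring.AlmostCommutativeRing using (AlmostCommutativeRing; fromCommutativeRing; _-Raw-AlmostCommutative⟶_)
import Algebra.Solver.Ring as RingSolver
open import Data.Bool using (Bool; true; false; if_then_else_; not; _∧_)
open import Data.Nat using (zero; suc; _∸_; _<_; _<ᵇ_; _≡ᵇ_; z≤n; s≤s) renaming (_+_ to _+ℕ_; _*_ to _*ℕ_)
import Data.Nat.Properties as ℕ
open import Data.Nat.Tactic.RingSolver using (solve-∀)
open import Data.Integer using (+_; -[1+_])
open import Data.Fin using (Fin; zero; suc)
open import Data.Fin.Properties using (suc-injective)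
open import Data.Vec using ([]; _∷_; lookup; tabulate; _[_]≔_)
open import Data.Vec.Properties using (lookup∘tabulate; lookup∘updateAt; lookup∘updateAt′; []≔-idempotent; []≔-lookup)
open import Data.List using (List; []; _∷_; _++_; map; concatMap; foldr; applyUpTo; upTo)
open import Data.List.Properties using (map-applyUpTo; map-concatMap; map-∘)
open import Data.Maybe using (nothing)
open import Data.Product using (_,_; proj₁; proj₂)
open import Data.Empty using (⊥-elim)
open import Function using (_∘_; id)
open import Function.Definitions using (Injective)
open import Relation.Binary.Bundles using (Setoid)
open import Relation.Binary.PropositionalEquality as ≡ using (_≡_; _≢_)
import Relation.Binary.Reasoning.Setoid as SetoidReasoning
open import Algebra.Properties.CommutativeSemigroup ℕ.+-commutativeSemigroup using (xy∙z≈zy∙x; xy∙z≈xz∙y)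

private
  <ᵇ-suc-flip : ∀ k s → (s <ᵇ suc k) ≡ not (k <ᵇ s)
  <ᵇ-suc-flip k       zero    = ≡.refl
  <ᵇ-suc-flip zero    (suc s) = ≡.refl
  <ᵇ-suc-flip (suc k) (suc s) = <ᵇ-suc-flip k s

  n<ᵇn≡false : ∀ k → (k <ᵇ k) ≡ false
  n<ᵇn≡false zero    = ≡.refl
  n<ᵇn≡false (suc k) = n<ᵇn≡false k

  <⇒<ᵇ≡true : ∀ {j k} → j < k → (j <ᵇ k) ≡ true
  <⇒<ᵇ≡true {zero}  {suc k} _         = ≡.refl
  <⇒<ᵇ≡true {suc j} {suc k} (s≤s j<k) = <⇒<ᵇ≡true j<k

  <ᵇ≡true⇒< : ∀ {j k} → (j <ᵇ k) ≡ true → j < k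
  <ᵇ≡true⇒< {zero}  {suc k} _  = s≤s z≤n
  <ᵇ≡true⇒< {suc j} {suc k} eq = s≤s (<ᵇ≡true⇒< eq)

  <ᵇ≡false⇒≥ : ∀ {j k} → (j <ᵇ k) ≡ false → k ≤ j
  <ᵇ≡false⇒≥ {j}     {zero}  _  = z≤n
  <ᵇ≡false⇒≥ {zero}  {suc k} ()
  <ᵇ≡false⇒≥ {suc j} {suc k} eq = s≤s (<ᵇ≡false⇒≥ eq)

  >⇒≡ᵇ≡false : ∀ {x y} → y < x → (x ≡ᵇ y) ≡ false
  >⇒≡ᵇ≡false {suc x} {zero}  _         = ≡.refl
  >⇒≡ᵇ≡false {suc x} {suc y} (s≤s y<x) = >⇒≡ᵇ≡false y<x

module FiniteSums {c ℓ} (R : CommutativeRing c ℓ) where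
  open CommutativeRing R
  open CommutativeSemigroupProperties +-commutativeSemigroup using (interchange)
  open SetoidReasoning setoid

  sum : List Carrier → Carrier
  sum = foldr _+_ 0#

  ∑ : ℕ → (ℕ → Carrier) → Carrier
  ∑ n f = sum (applyUpTo f n)

  sum-++ : ∀ xs ys → sum (xs ++ ys) ≈ sum xs + sum ys
  sum-++ []       ys = sym (+-identityˡ _)
  sum-++ (x ∷ xs) ys = trans (+-congˡ (sum-++ xs ys)) (sym (+-assoc x _ _))

  sum-concatMap : ∀ {a} {A : Set a} (f : A → List Carrier) xs →
                  sum (concatMap f xs) ≈ sum (map (sum ∘ f) xs)
  sum-concatMap f []       = refl
  sum-concatMap f (x ∷ xs) = trans (sum-++ (f x) (concatMap f xs)) (+-congˡ (sum-concatMap f xs))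

  sum-map-cong : ∀ {a} {A : Set a} {f g : A → Carrier} xs → (∀ x → f x ≈ g x) →
                 sum (map f xs) ≈ sum (map g xs)
  sum-map-cong []       f≈g = refl
  sum-map-cong (x ∷ xs) f≈g = +-cong (f≈g x) (sum-map-cong xs f≈g)

  sum-map-zero : ∀ {a} {A : Set a} {f : A → Carrier} xs → (∀ x → f x ≈ 0#) → sum (map f xs) ≈ 0#
  sum-map-zero []       f≈0 = refl
  sum-map-zero (x ∷ xs) f≈0 = trans (+-cong (f≈0 x) (sum-map-zero xs f≈0)) (+-identityˡ 0#)

  sum-map-*ˡ : ∀ {a} {A : Set a} k (f : A → Carrier) xs →
               k * sum (map f xs) ≈ sum (map (λ x → k * f x) xs)
  sum-map-*ˡ k f []       = zeroʳ k
  sum-map-*ˡ k f (x ∷ xs) = trans (distribˡ k _ _) (+-congˡ (sum-map-*ˡ k f xs))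

  sum-map-upTo : ∀ f n → sum (map f (upTo n)) ≈ ∑ n f
  sum-map-upTo f n = reflexive (≡.cong sum (map-applyUpTo (λ x → x) f n))

  ∑-cong-< : ∀ n {f g : ℕ → Carrier} → (∀ j → j < n → f j ≈ g j) → ∑ n f ≈ ∑ n g
  ∑-cong-< zero    f≈g = refl
  ∑-cong-< (suc n) f≈g = +-cong (f≈g 0 (s≤s z≤n)) (∑-cong-< n (λ j j<n → f≈g (suc j) (s≤s j<n)))

  ∑-cong : ∀ n {f g : ℕ → Carrier} → (∀ j → f j ≈ g j) → ∑ n f ≈ ∑ n g
  ∑-cong n f≈g = ∑-cong-< n (λ j _ → f≈g j)

  ∑-zero-< : ∀ n {f : ℕ → Carrier} → (∀ j → j < n → f j ≈ 0#) → ∑ n f ≈ 0#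
  ∑-zero-< zero    f≈0 = refl
  ∑-zero-< (suc n) f≈0 =
    trans (+-cong (f≈0 0 (s≤s z≤n)) (∑-zero-< n (λ j j<n → f≈0 (suc j) (s≤s j<n)))) (+-identityˡ 0#)

  ∑-zero : ∀ n {f : ℕ → Carrier} → (∀ j → f j ≈ 0#) → ∑ n f ≈ 0#
  ∑-zero n f≈0 = ∑-zero-< n (λ j _ → f≈0 j)

  ∑-distrib-+ : ∀ n (f g : ℕ → Carrier) → ∑ n (λ j → f j + g j) ≈ ∑ n f + ∑ n g
  ∑-distrib-+ zero    f g = sym (+-identityˡ 0#)
  ∑-distrib-+ (suc n) f g = trans (+-congˡ (∑-distrib-+ n (f ∘ suc) (g ∘ suc))) (interchange _ _ _ _)

  ∑-*ˡ : ∀ n k (f : ℕ → Carrier) → k * ∑ n f ≈ ∑ n (λ j → k * f j)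
  ∑-*ˡ zero    k f = zeroʳ k
  ∑-*ˡ (suc n) k f = trans (distribˡ k _ _) (+-congˡ (∑-*ˡ n k (f ∘ suc)))

  ∑-snoc : ∀ n (f : ℕ → Carrier) → ∑ (suc n) f ≈ ∑ n f + f n
  ∑-snoc zero    f = trans (+-identityʳ _) (sym (+-identityˡ _))
  ∑-snoc (suc n) f = trans (+-congˡ (∑-snoc n (f ∘ suc))) (sym (+-assoc _ _ _))

  ∑-reverse : ∀ n (f : ℕ → Carrier) → ∑ n f ≈ ∑ n (λ j → f (n ∸ suc j))
  ∑-reverse zero    f = refl
  ∑-reverse (suc n) f = begin
    ∑ (suc n) f                      ≈⟨ ∑-snoc n f ⟩
    ∑ n f + f n                      ≈⟨ +-comm _ _ ⟩
    f n + ∑ n f                      ≈⟨ +-congˡ (∑-reverse n f) ⟩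
    f n + ∑ n (λ j → f (n ∸ suc j))  ∎

  ∑-only-last : ∀ n (f : ℕ → Carrier) → (∀ j → j < n → f j ≈ 0#) → ∑ (suc n) f ≈ f n
  ∑-only-last n f f≈0 = trans (∑-snoc n f) (trans (+-congʳ (∑-zero-< n f≈0)) (+-identityˡ _))

module PowerSeries {c ℓ} (R : CommutativeRing c ℓ) where
  open CommutativeRing R
  open FiniteSums R
  open SetoidReasoning setoid

  Series : Set c
  Series = ℕ → Carrier

  infix 4 _≈ₛ_
  infixl 6 _+ₛ_
  infixl 7 _*ₛ_

  _≈ₛ_ : Series → Series → Set ℓ
  f ≈ₛ g = ∀ i → f i ≈ g i

  _+ₛ_ : Series → Series → Series
  (f +ₛ g) i = f i + g i

  -ₛ_ : Series → Series
  (-ₛ f) i = - f i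

  0ₛ : Series
  0ₛ _ = 0#

  1ₛ : Series
  1ₛ zero    = 1#
  1ₛ (suc _) = 0#

  _*ₛ_ : Series → Series → Series
  (f *ₛ g) i = ∑ (suc i) (λ j → f j * g (i ∸ j))

  private
    ∸-involutive : ∀ i j → j < suc i → i ∸ (i ∸ j) ≡ j
    ∸-involutive i       zero    _         = ℕ.n∸n≡0 i
    ∸-involutive (suc i) (suc j) (s≤s j≤i) =
      ≡.trans (ℕ.+-∸-assoc 1 (ℕ.m∸n≤m i j)) (≡.cong suc (∸-involutive i j j≤i))

  *ₛ-comm : ∀ f g → f *ₛ g ≈ₛ g *ₛ f
  *ₛ-comm f g i = begin
    ∑ (suc i) (λ j → f j * g (i ∸ j))              ≈⟨ ∑-reverse (suc i) (λ j → f j * g (i ∸ j)) ⟩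
    ∑ (suc i) (λ j → f (i ∸ j) * g (i ∸ (i ∸ j)))  ≈⟨ ∑-cong-< (suc i) swap ⟩
    ∑ (suc i) (λ j → g j * f (i ∸ j))              ∎
    where
    swap : ∀ j → j < suc i → f (i ∸ j) * g (i ∸ (i ∸ j)) ≈ g j * f (i ∸ j)
    swap j j≤i = trans (*-comm _ _) (*-congʳ (reflexive (≡.cong g (∸-involutive i j j≤i))))

  *ₛ-cong : ∀ {f f′ g g′} → f ≈ₛ f′ → g ≈ₛ g′ → f *ₛ g ≈ₛ f′ *ₛ g′
  *ₛ-cong {f} {f′} {g} {g′} f≈f′ g≈g′ i =
    ∑-cong (suc i) {λ j → f j * g (i ∸ j)} {λ j → f′ j * g′ (i ∸ j)} (λ j → *-cong (f≈f′ j) (g≈g′ (i ∸ j)))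

  *ₛ-distribˡ : ∀ f g h → f *ₛ (g +ₛ h) ≈ₛ f *ₛ g +ₛ f *ₛ h
  *ₛ-distribˡ f g h i =
    trans (∑-cong (suc i) {g = λ j → f j * g (i ∸ j) + f j * h (i ∸ j)} (λ j → distribˡ (f j) _ _))
          (∑-distrib-+ (suc i) (λ j → f j * g (i ∸ j)) (λ j → f j * h (i ∸ j)))

  *ₛ-distribʳ : ∀ f g h → (g +ₛ h) *ₛ f ≈ₛ g *ₛ f +ₛ h *ₛ f
  *ₛ-distribʳ f g h i =
    trans (∑-cong (suc i) {g = λ j → g j * f (i ∸ j) + h j * f (i ∸ j)} (λ j → distribʳ (f (i ∸ j)) _ _))
          (∑-distrib-+ (suc i) (λ j → g j * f (i ∸ j)) (λ j → h j * f (i ∸ j)))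

  *ₛ-identityˡ : ∀ f → 1ₛ *ₛ f ≈ₛ f
  *ₛ-identityˡ f zero    = trans (+-identityʳ _) (*-identityˡ _)
  *ₛ-identityˡ f (suc i) =
    trans (+-cong (*-identityˡ _) (∑-zero (suc i) {λ j → 1ₛ (suc j) * f (i ∸ j)} (λ j → zeroˡ _)))
          (+-identityʳ _)

  scaleₛ : Carrier → Series → Series
  scaleₛ a g k = a * g k

  scaleₛ-*ₛ : ∀ a g h → scaleₛ a g *ₛ h ≈ₛ scaleₛ a (g *ₛ h)
  scaleₛ-*ₛ a g h i = trans (∑-cong (suc i) {g = λ j → a * (g j * h (i ∸ j))} (λ j → *-assoc a _ _))
                            (sym (∑-*ˡ (suc i) a (λ j → g j * h (i ∸ j))))

  -- The coefficient of ε^(i+1) in a product splits off the term f 0 · g (i+1);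
  -- the remaining terms form the coefficient of ε^i in (f ∘ suc) *ₛ g.
  *ₛ-assoc : ∀ f g h → (f *ₛ g) *ₛ h ≈ₛ f *ₛ (g *ₛ h)
  *ₛ-assoc f g h zero = begin
    ((f 0 * g 0 + 0#) * h 0) + 0#  ≈⟨ +-identityʳ _ ⟩
    (f 0 * g 0 + 0#) * h 0         ≈⟨ *-congʳ (+-identityʳ _) ⟩
    (f 0 * g 0) * h 0              ≈⟨ *-assoc _ _ _ ⟩
    f 0 * (g 0 * h 0)              ≈⟨ *-congˡ (+-identityʳ _) ⟨
    f 0 * (g 0 * h 0 + 0#)         ≈⟨ +-identityʳ _ ⟨
    f 0 * (g 0 * h 0 + 0#) + 0#    ∎
  *ₛ-assoc f g h (suc i) = begin
    (f *ₛ g) 0 * h (suc i) + (((f *ₛ g) ∘ suc) *ₛ h) i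
      ≈⟨ +-cong (*-congʳ (+-identityʳ _)) (*ₛ-distribʳ h (scaleₛ (f 0) (g ∘ suc)) ((f ∘ suc) *ₛ g) i) ⟩
    (f 0 * g 0) * h (suc i) + ((scaleₛ (f 0) (g ∘ suc) *ₛ h) i + (((f ∘ suc) *ₛ g) *ₛ h) i)
      ≈⟨ +-cong (*-assoc _ _ _) (+-cong (scaleₛ-*ₛ (f 0) (g ∘ suc) h i) (*ₛ-assoc (f ∘ suc) g h i)) ⟩
    f 0 * (g 0 * h (suc i)) + (f 0 * ((g ∘ suc) *ₛ h) i + ((f ∘ suc) *ₛ (g *ₛ h)) i)
      ≈⟨ +-assoc _ _ _ ⟨
    (f 0 * (g 0 * h (suc i)) + f 0 * ((g ∘ suc) *ₛ h) i) + ((f ∘ suc) *ₛ (g *ₛ h)) i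
      ≈⟨ +-congʳ (distribˡ _ _ _) ⟨
    f 0 * (g *ₛ h) (suc i) + ((f ∘ suc) *ₛ (g *ₛ h)) i
      ∎

  powerSeriesRing : CommutativeRing c ℓ
  powerSeriesRing = record
    { Carrier = Series ; _≈_ = _≈ₛ_ ; _+_ = _+ₛ_ ; _*_ = _*ₛ_ ; -_ = -ₛ_ ; 0# = 0ₛ ; 1# = 1ₛ
    ; isCommutativeRing = record
      { isRing = record
        { +-isAbelianGroup = record
          { isGroup = record
            { isMonoid = record
              { isSemigroup = record
                { isMagma = record
                  { isEquivalence = record
                    { refl = λ _ → refl ; sym = λ p i → sym (p i) ; trans = λ p q i → trans (p i) (q i) }
                  ; ∙-cong = λ p q i → +-cong (p i) (q i) }
                ; assoc = λ f g h i → +-assoc (f i) (g i) (h i) }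
              ; identity = (λ f i → +-identityˡ (f i)) , (λ f i → +-identityʳ (f i)) }
            ; inverse = (λ f i → -‿inverseˡ (f i)) , (λ f i → -‿inverseʳ (f i))
            ; ⁻¹-cong = λ p i → -‿cong (p i) }
          ; comm = λ f g i → +-comm (f i) (g i) }
        ; *-cong = *ₛ-cong
        ; *-assoc = *ₛ-assoc
        ; *-identity = *ₛ-identityˡ , (λ f i → trans (*ₛ-comm f 1ₛ i) (*ₛ-identityˡ f i))
        ; distrib = *ₛ-distribˡ , *ₛ-distribʳ }
      ; *-comm = *ₛ-comm } }

-- X carries the kernel equivalence x ≈ y ⇔ ⟦ x ⟧ ≈ ⟦ y ⟧, which makes ⟦_⟧ a monomorphism.
module Pullback {c ℓ c′} (R : CommutativeRing c ℓ) {X : Set c′}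
  (⟦_⟧ : X → CommutativeRing.Carrier R)
  (_⊕_ _⊛_ : Op₂ X) (⊝_ : Op₁ X) (0ₓ 1ₓ : X)
  where
  open CommutativeRing R

  pulledBackRawRing : RawRing c′ ℓ
  pulledBackRawRing = record
    { Carrier = X ; _≈_ = λ x y → ⟦ x ⟧ ≈ ⟦ y ⟧
    ; _+_ = _⊕_ ; _*_ = _⊛_ ; -_ = ⊝_ ; 0# = 0ₓ ; 1# = 1ₓ }

  module _
    (+-homo : ∀ x y → ⟦ x ⊕ y ⟧ ≈ ⟦ x ⟧ + ⟦ y ⟧)
    (*-homo : ∀ x y → ⟦ x ⊛ y ⟧ ≈ ⟦ x ⟧ * ⟦ y ⟧)
    (-‿homo : ∀ x → ⟦ ⊝ x ⟧ ≈ - ⟦ x ⟧)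
    (0#-homo : ⟦ 0ₓ ⟧ ≈ 0#)
    (1#-homo : ⟦ 1ₓ ⟧ ≈ 1#)
    where

    isRingMonomorphism : IsRingMonomorphism pulledBackRawRing rawRing ⟦_⟧
    isRingMonomorphism = record
      { isRingHomomorphism = record
        { isSemiringHomomorphism = record
          { isNearSemiringHomomorphism = record
            { +-isMonoidHomomorphism = record
              { isMagmaHomomorphism = record
                { isRelHomomorphism = record { cong = λ x≈y → x≈y }
                ; homo = +-homo }
              ; ε-homo = 0#-homo }
            ; *-homo = *-homo }
          ; 1#-homo = 1#-homo }
        ; -‿homo = -‿homo }
      ; injective = λ x≈y → x≈y }

    pulledBackRing : CommutativeRing c′ ℓ
    pulledBackRing = record
      { isCommutativeRing =
          RingMonomorphism.isCommutativeRing isRingMonomorphism isCommutativeRing }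

module MultivariateSeries {c ℓ} (R : CommutativeRing c ℓ) where
  open CommutativeRing R
  open FiniteSums R
  open PowerSeries R using (1ₛ; powerSeriesRing)
  open SetoidReasoning setoid

  Coeffs : ℕ → Set c
  Coeffs n = Monomial n → ℕ → Carrier

  infix  4 _≋_
  infixl 6 _+ᶜ_
  infixl 7 _*ᶜ_

  _≋_ : ∀ {n} → Coeffs n → Coeffs n → Set ℓ
  P ≋ Q = ∀ m i → P m i ≈ Q m i

  _+ᶜ_ : ∀ {n} → Coeffs n → Coeffs n → Coeffs n
  (P +ᶜ Q) m i = P m i + Q m i

  -ᶜ_ : ∀ {n} → Coeffs n → Coeffs n
  (-ᶜ P) m i = - P m i

  0ᶜ : ∀ {n} → Coeffs n
  0ᶜ m i = 0#

  1ᶜ : ∀ {n} → Coeffs n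
  1ᶜ m i = if allZero m then 1ₛ i else 0#

  _*ᶜ_ : ∀ {n} → Coeffs n → Coeffs n → Coeffs n
  (P *ᶜ Q) m i =
    sum (concatMap (λ uv → map (λ j → P (proj₁ uv) j * Q (proj₂ uv) (i ∸ j)) (upTo (suc i))) (splits m))

  ≋-refl : ∀ {n} {P : Coeffs n} → P ≋ P
  ≋-refl _ _ = refl

  ≋-sym : ∀ {n} {P Q : Coeffs n} → P ≋ Q → Q ≋ P
  ≋-sym P≋Q m i = sym (P≋Q m i)

  ≋-trans : ∀ {n} {P Q S : Coeffs n} → P ≋ Q → Q ≋ S → P ≋ S
  ≋-trans P≋Q Q≋S m i = trans (P≋Q m i) (Q≋S m i)

  +ᶜ-cong : ∀ {n} {P P′ Q Q′ : Coeffs n} → P ≋ P′ → Q ≋ Q′ → P +ᶜ Q ≋ P′ +ᶜ Q′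
  +ᶜ-cong P≋P′ Q≋Q′ m i = +-cong (P≋P′ m i) (Q≋Q′ m i)

  *ᶜ-as-sum : ∀ {n} (P Q : Coeffs n) m i →
              (P *ᶜ Q) m i ≈ sum (map (λ uv → ∑ (suc i) (λ j → P (proj₁ uv) j * Q (proj₂ uv) (i ∸ j))) (splits m))
  *ᶜ-as-sum P Q m i = trans (sum-concatMap _ (splits m))
    (sum-map-cong (splits m) (λ uv → sum-map-upTo (λ j → P (proj₁ uv) j * Q (proj₂ uv) (i ∸ j)) (suc i)))

  sum-splits-∷ : ∀ {n} a (m : Monomial n) (f : Monomial (suc n) × Monomial (suc n) → Carrier) →
                 sum (map f (splits (a ∷ m)))
                   ≈ ∑ (suc a) (λ k → sum (map (λ uv → f (k ∷ proj₁ uv , (a ∸ k) ∷ proj₂ uv)) (splits m)))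
  sum-splits-∷ a m f = begin
    sum (map f (concatMap H (upTo (suc a))))
      ≡⟨ ≡.cong sum (map-concatMap f H (upTo (suc a))) ⟩
    sum (concatMap (map f ∘ H) (upTo (suc a)))
      ≈⟨ sum-concatMap (map f ∘ H) (upTo (suc a)) ⟩
    sum (map (sum ∘ map f ∘ H) (upTo (suc a)))
      ≈⟨ sum-map-cong (upTo (suc a)) (λ k → reflexive (≡.cong sum (≡.sym (map-∘ (splits m))))) ⟩
    sum (map (λ k → sum (map (f ∘ cons k) (splits m))) (upTo (suc a)))
      ≈⟨ sum-map-upTo (λ k → sum (map (f ∘ cons k) (splits m))) (suc a) ⟩
    ∑ (suc a) (λ k → sum (map (f ∘ cons k) (splits m))) ∎
    where
    cons : ℕ → _ → Monomial _ × Monomial _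
    cons k uv = (k ∷ proj₁ uv , (a ∸ k) ∷ proj₂ uv)
    H : ℕ → List (Monomial _ × Monomial _)
    H k = map (cons k) (splits m)

  *ᶜ-∷ : ∀ {n} (P Q : Coeffs (suc n)) a m i →
         (P *ᶜ Q) (a ∷ m) i ≈ ∑ (suc a) (λ k → ((λ u → P (k ∷ u)) *ᶜ (λ v → Q ((a ∸ k) ∷ v))) m i)
  *ᶜ-∷ P Q a m i = begin
    (P *ᶜ Q) (a ∷ m) i
      ≈⟨ *ᶜ-as-sum P Q (a ∷ m) i ⟩
    sum (map (λ uv → ∑ (suc i) (λ j → P (proj₁ uv) j * Q (proj₂ uv) (i ∸ j))) (splits (a ∷ m)))
      ≈⟨ sum-splits-∷ a m _ ⟩
    ∑ (suc a) (λ k → sum (map (λ uv → ∑ (suc i) (λ j → P (k ∷ proj₁ uv) j * Q ((a ∸ k) ∷ proj₂ uv) (i ∸ j))) (splits m)))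
      ≈⟨ ∑-cong (suc a) (λ k → sym (*ᶜ-as-sum (λ u → P (k ∷ u)) (λ v → Q ((a ∸ k) ∷ v)) m i)) ⟩
    ∑ (suc a) (λ k → ((λ u → P (k ∷ u)) *ᶜ (λ v → Q ((a ∸ k) ∷ v))) m i) ∎

  private
    ∑-pointwise : ∀ {n} k (f : ℕ → Coeffs n) m i → foldr _+ᶜ_ 0ᶜ (applyUpTo f k) m i ≈ ∑ k (λ j → f j m i)
    ∑-pointwise zero    f m i = refl
    ∑-pointwise (suc k) f m i = +-congˡ (∑-pointwise k (f ∘ suc) m i)

  -- Currying views Coeffs (n+1) as power series in x₁ over Coeffs n (the product is
  -- matched by *ᶜ-∷), and Coeffs 0 as R[[ε]]; the ring laws of Coeffs n are then
  -- pulled back from these iterated power series rings.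
  mutual
    ambientRing : ℕ → CommutativeRing c ℓ
    ambientRing zero    = powerSeriesRing
    ambientRing (suc n) = PowerSeries.powerSeriesRing (coefficientRing n)

    coefficientRing : ℕ → CommutativeRing c ℓ
    coefficientRing n = Pullback.pulledBackRing (ambientRing n) (curryᶜ n) _+ᶜ_ _*ᶜ_ -ᶜ_ 0ᶜ 1ᶜ
      (+ᶜ-homo n) (*ᶜ-homo n) (-ᶜ-homo n) (0ᶜ-homo n) (1ᶜ-homo n)

    curryᶜ : ∀ n → Coeffs n → CommutativeRing.Carrier (ambientRing n)
    curryᶜ zero    P     = P []
    curryᶜ (suc n) P a m = P (a ∷ m)

    ≋⇒curry≈ : ∀ n {P Q : Coeffs n} → P ≋ Q → CommutativeRing._≈_ (ambientRing n) (curryᶜ n P) (curryᶜ n Q)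
    ≋⇒curry≈ zero    P≋Q i = P≋Q [] i
    ≋⇒curry≈ (suc n) P≋Q a = ≋⇒curry≈ n (λ m i → P≋Q (a ∷ m) i)

    +ᶜ-homo : ∀ n (P Q : Coeffs n) →
      CommutativeRing._≈_ (ambientRing n) (curryᶜ n (P +ᶜ Q)) (CommutativeRing._+_ (ambientRing n) (curryᶜ n P) (curryᶜ n Q))
    +ᶜ-homo zero    P Q _ = refl
    +ᶜ-homo (suc n) P Q a = ≋⇒curry≈ n ≋-refl

    -ᶜ-homo : ∀ n (P : Coeffs n) →
      CommutativeRing._≈_ (ambientRing n) (curryᶜ n (-ᶜ P)) (CommutativeRing.-_ (ambientRing n) (curryᶜ n P))
    -ᶜ-homo zero    P _ = refl
    -ᶜ-homo (suc n) P a = ≋⇒curry≈ n ≋-refl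

    0ᶜ-homo : ∀ n → CommutativeRing._≈_ (ambientRing n) (curryᶜ n 0ᶜ) (CommutativeRing.0# (ambientRing n))
    0ᶜ-homo zero    _ = refl
    0ᶜ-homo (suc n) a = ≋⇒curry≈ n ≋-refl

    1ᶜ-homo : ∀ n → CommutativeRing._≈_ (ambientRing n) (curryᶜ n 1ᶜ) (CommutativeRing.1# (ambientRing n))
    1ᶜ-homo zero    zero    = refl
    1ᶜ-homo zero    (suc i) = refl
    1ᶜ-homo (suc n) zero    = ≋⇒curry≈ n ≋-refl
    1ᶜ-homo (suc n) (suc a) = ≋⇒curry≈ n ≋-refl

    *ᶜ-homo : ∀ n (P Q : Coeffs n) →
      CommutativeRing._≈_ (ambientRing n) (curryᶜ n (P *ᶜ Q)) (CommutativeRing._*_ (ambientRing n) (curryᶜ n P) (curryᶜ n Q))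
    *ᶜ-homo zero    P Q i = trans (*ᶜ-as-sum P Q [] i) (+-identityʳ _)
    *ᶜ-homo (suc n) P Q a = ≋⇒curry≈ n (λ m i →
      trans (*ᶜ-∷ P Q a m i) (sym (∑-pointwise (suc a) (λ k → (λ u → P (k ∷ u)) *ᶜ (λ v → Q ((a ∸ k) ∷ v))) m i)))

  curry≈⇒≋ : ∀ n {P Q : Coeffs n} → CommutativeRing._≈_ (ambientRing n) (curryᶜ n P) (curryᶜ n Q) → P ≋ Q
  curry≈⇒≋ zero    P≈Q []      i = P≈Q i
  curry≈⇒≋ (suc n) P≈Q (a ∷ m) i = curry≈⇒≋ n (P≈Q a) m i

  module _ {n : ℕ} where
    private module Ring = CommutativeRing (coefficientRing n)

    *ᶜ-cong : ∀ {P P′ Q Q′ : Coeffs n} → P ≋ P′ → Q ≋ Q′ → P *ᶜ Q ≋ P′ *ᶜ Q′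
    *ᶜ-cong P≋P′ Q≋Q′ = curry≈⇒≋ n (Ring.*-cong (≋⇒curry≈ n P≋P′) (≋⇒curry≈ n Q≋Q′))

    *ᶜ-assoc : ∀ (P Q S : Coeffs n) → (P *ᶜ Q) *ᶜ S ≋ P *ᶜ (Q *ᶜ S)
    *ᶜ-assoc P Q S = curry≈⇒≋ n (Ring.*-assoc P Q S)

    *ᶜ-comm : ∀ (P Q : Coeffs n) → P *ᶜ Q ≋ Q *ᶜ P
    *ᶜ-comm P Q = curry≈⇒≋ n (Ring.*-comm P Q)

    *ᶜ-identityˡ : ∀ (P : Coeffs n) → 1ᶜ *ᶜ P ≋ P
    *ᶜ-identityˡ P = curry≈⇒≋ n (Ring.*-identityˡ P)

    *ᶜ-distribˡ : ∀ (P Q S : Coeffs n) → P *ᶜ (Q +ᶜ S) ≋ P *ᶜ Q +ᶜ P *ᶜ S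
    *ᶜ-distribˡ P Q S = curry≈⇒≋ n (Ring.distribˡ P Q S)

module EpsilonShift {c ℓ} (R : CommutativeRing c ℓ) where
  open CommutativeRing R
  open import Algebra.Properties.Ring ring using (-0#≈0#)
  open FiniteSums R
  open MultivariateSeries R

  ≋-setoid : ℕ → Setoid c ℓ
  ≋-setoid n = record
    { Carrier = Coeffs n ; _≈_ = _≋_
    ; isEquivalence = record { refl = ≋-refl ; sym = ≋-sym ; trans = ≋-trans } }

  module ≋-Reasoning {n : ℕ} = SetoidReasoning (≋-setoid n)

  -- ε^k · P
  shift : ∀ {n} → ℕ → Coeffs n → Coeffs n
  shift k P m i = if i <ᵇ k then 0# else P m (i ∸ k)

  module _ {n : ℕ} where

    shift-cong : ∀ k {P Q : Coeffs n} → P ≋ Q → shift k P ≋ shift k Q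
    shift-cong k P≋Q m i with i <ᵇ k
    ... | true  = refl
    ... | false = P≋Q m (i ∸ k)

    shift-+ᶜ : ∀ k (P Q : Coeffs n) → shift k (P +ᶜ Q) ≋ shift k P +ᶜ shift k Q
    shift-+ᶜ k P Q m i with i <ᵇ k
    ... | true  = sym (+-identityˡ 0#)
    ... | false = refl

    shift-negᶜ : ∀ k (P : Coeffs n) → shift k (-ᶜ P) ≋ -ᶜ shift k P
    shift-negᶜ k P m i with i <ᵇ k
    ... | true  = sym -0#≈0#
    ... | false = refl

    shift-0ᶜ : ∀ k → shift k (0ᶜ {n}) ≋ 0ᶜ
    shift-0ᶜ k m i with i <ᵇ k
    ... | true  = refl
    ... | false = refl

    private
      shift-suc : ∀ k (P : Coeffs n) → shift (suc k) P ≋ shift 1 (shift k P)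
      shift-suc k P m zero    = refl
      shift-suc k P m (suc i) = refl

    shift-+ : ∀ a b (P : Coeffs n) → shift a (shift b P) ≋ shift (a +ℕ b) P
    shift-+ zero    b P = ≋-refl
    shift-+ (suc a) b P =
      ≋-trans (shift-suc a (shift b P)) (≋-trans (shift-cong 1 (shift-+ a b P)) (≋-sym (shift-suc (a +ℕ b) P)))

    shift-shift : ∀ a b c d (P : Coeffs n) → a +ℕ b ≡ c +ℕ d → shift a (shift b P) ≋ shift c (shift d P)
    shift-shift a b c d P eq =
      ≋-trans (shift-+ a b P) (≋-trans (λ m i → reflexive (≡.cong (λ k → shift k P m i) eq)) (≋-sym (shift-+ c d P)))

    shift-comm : ∀ a b (P : Coeffs n) → shift a (shift b P) ≋ shift b (shift a P)
    shift-comm a b P = shift-shift a b b a P (ℕ.+-comm a b)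

    shift-cancel : ∀ k (P : Coeffs n) m i → shift k P m (i +ℕ k) ≈ P m i
    shift-cancel zero    P m i = reflexive (≡.cong (P m) (ℕ.+-identityʳ i))
    shift-cancel (suc k) P m i = trans (reflexive (≡.cong (shift (suc k) P m) (ℕ.+-suc i k))) (shift-cancel k P m i)

    shift-injective : ∀ k {P Q : Coeffs n} → shift k P ≋ shift k Q → P ≋ Q
    shift-injective k {P} {Q} eq m i = trans (sym (shift-cancel k P m i)) (trans (eq m (i +ℕ k)) (shift-cancel k Q m i))

    private
      shift-1-*ᶜ : ∀ (P Q : Coeffs n) → shift 1 (P *ᶜ Q) ≋ shift 1 P *ᶜ Q
      shift-1-*ᶜ P Q m zero =
        sym (trans (*ᶜ-as-sum (shift 1 P) Q m 0) (sum-map-zero (splits m) (λ uv → trans (+-identityʳ _) (zeroˡ _))))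
      shift-1-*ᶜ P Q m (suc i) = sym (begin
        (shift 1 P *ᶜ Q) m (suc i)
          ≈⟨ *ᶜ-as-sum (shift 1 P) Q m (suc i) ⟩
        sum (map (λ uv → ∑ (suc (suc i)) (λ j → shift 1 P (proj₁ uv) j * Q (proj₂ uv) (suc i ∸ j))) (splits m))
          ≈⟨ sum-map-cong (splits m) (λ uv → trans (+-congʳ (zeroˡ _)) (+-identityˡ _)) ⟩
        sum (map (λ uv → ∑ (suc i) (λ j → P (proj₁ uv) j * Q (proj₂ uv) (i ∸ j))) (splits m))
          ≈⟨ *ᶜ-as-sum P Q m i ⟨
        (P *ᶜ Q) m i ∎)
        where open SetoidReasoning setoid

    shift-*ᶜ : ∀ k (P Q : Coeffs n) → shift k (P *ᶜ Q) ≋ shift k P *ᶜ Q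
    shift-*ᶜ zero    P Q = ≋-refl
    shift-*ᶜ (suc k) P Q = begin
      shift (suc k) (P *ᶜ Q)     ≈⟨ shift-suc k (P *ᶜ Q) ⟩
      shift 1 (shift k (P *ᶜ Q)) ≈⟨ shift-cong 1 (shift-*ᶜ k P Q) ⟩
      shift 1 (shift k P *ᶜ Q)   ≈⟨ shift-1-*ᶜ (shift k P) Q ⟩
      shift 1 (shift k P) *ᶜ Q   ≈⟨ *ᶜ-cong (shift-suc k P) ≋-refl ⟨
      shift (suc k) P *ᶜ Q       ∎
      where open ≋-Reasoning

    shift-*ᶜʳ : ∀ k (P Q : Coeffs n) → shift k (P *ᶜ Q) ≋ P *ᶜ shift k Q
    shift-*ᶜʳ k P Q = ≋-trans (shift-cong k (*ᶜ-comm P Q)) (≋-trans (shift-*ᶜ k Q P) (*ᶜ-comm (shift k Q) P))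

module LaurentPolynomials {c ℓ} (F : Field c ℓ) (n : ℕ) where
  open Field F
  open WithField F
  open MultivariateSeries commutativeRing
  open EpsilonShift commutativeRing

  -- Equality of Laurent polynomials, by cross-multiplying the fractions ε^(-sh p) · co p.
  infix 4 _≈ᴸ_
  record _≈ᴸ_ (p q : LPoly n) : Set ℓ where
    constructor mk≈ᴸ
    field cross-multiplied : shift (sh q) (co p) ≋ shift (sh p) (co q)

  negP : LPoly n → LPoly n
  negP p = lpoly (sh p) (-ᶜ co p)

  zeroP : LPoly n
  zeroP = lpoly 0 0ᶜ

  oneP : LPoly n
  oneP = lpoly 0 1ᶜ

  ≈ᴸ-common-shift : ∀ {p q} a b → sh p +ℕ a ≡ sh q +ℕ b → shift a (co p) ≋ shift b (co q) → p ≈ᴸ q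
  ≈ᴸ-common-shift {p} {q} a b eq εᵃp≋εᵇq = mk≈ᴸ (shift-injective a (begin
    shift a (shift (sh q) (co p)) ≈⟨ shift-comm a (sh q) (co p) ⟩
    shift (sh q) (shift a (co p)) ≈⟨ shift-cong (sh q) εᵃp≋εᵇq ⟩
    shift (sh q) (shift b (co q)) ≈⟨ shift-shift (sh q) b a (sh p) (co q) (≡.trans (≡.sym eq) (ℕ.+-comm (sh p) a)) ⟩
    shift a (shift (sh p) (co q)) ∎))
    where open ≋-Reasoning

  ≈ᴸ-from-≋ : ∀ {p q} → sh p ≡ sh q → co p ≋ co q → p ≈ᴸ q
  ≈ᴸ-from-≋ eq = ≈ᴸ-common-shift 0 0 (≡.cong (_+ℕ 0) eq)

  ≈ᴸ-refl : ∀ {p} → p ≈ᴸ p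
  ≈ᴸ-refl = mk≈ᴸ ≋-refl

  ≈ᴸ-sym : ∀ {p q} → p ≈ᴸ q → q ≈ᴸ p
  ≈ᴸ-sym (mk≈ᴸ eq) = mk≈ᴸ (≋-sym eq)

  ≈ᴸ-trans : ∀ {p q r} → p ≈ᴸ q → q ≈ᴸ r → p ≈ᴸ r
  ≈ᴸ-trans {p} {q} {r} (mk≈ᴸ p≈q) (mk≈ᴸ q≈r) = mk≈ᴸ (shift-injective (sh q) (begin
    shift (sh q) (shift (sh r) (co p)) ≈⟨ shift-comm (sh q) (sh r) (co p) ⟩
    shift (sh r) (shift (sh q) (co p)) ≈⟨ shift-cong (sh r) p≈q ⟩
    shift (sh r) (shift (sh p) (co q)) ≈⟨ shift-comm (sh r) (sh p) (co q) ⟩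
    shift (sh p) (shift (sh r) (co q)) ≈⟨ shift-cong (sh p) q≈r ⟩
    shift (sh p) (shift (sh q) (co r)) ≈⟨ shift-comm (sh p) (sh q) (co r) ⟩
    shift (sh q) (shift (sh p) (co r)) ∎))
    where open ≋-Reasoning

  addP-comm : ∀ p q → addP p q ≈ᴸ addP q p
  addP-comm p q = ≈ᴸ-from-≋ (ℕ.+-comm (sh p) (sh q)) (λ m i → +-comm _ _)

  addP-congˡ : ∀ {p p′} q → p ≈ᴸ p′ → addP p q ≈ᴸ addP p′ q
  addP-congˡ {p} {p′} q (mk≈ᴸ p≈p′) = mk≈ᴸ (begin
    shift (sp′ +ℕ sq) (shift sq P +ᶜ shift sp Q)
      ≈⟨ shift-+ᶜ (sp′ +ℕ sq) (shift sq P) (shift sp Q) ⟩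
    shift (sp′ +ℕ sq) (shift sq P) +ᶜ shift (sp′ +ℕ sq) (shift sp Q)
      ≈⟨ +ᶜ-cong (shift-shift (sp′ +ℕ sq) sq (sq +ℕ sq) sp′ P (xy∙z≈zy∙x sp′ sq sq))
                 (shift-shift (sp′ +ℕ sq) sp (sp +ℕ sq) sp′ Q (xy∙z≈zy∙x sp′ sq sp)) ⟩
    shift (sq +ℕ sq) (shift sp′ P) +ᶜ shift (sp +ℕ sq) (shift sp′ Q)
      ≈⟨ +ᶜ-cong (shift-cong (sq +ℕ sq) p≈p′) ≋-refl ⟩
    shift (sq +ℕ sq) (shift sp P′) +ᶜ shift (sp +ℕ sq) (shift sp′ Q)
      ≈⟨ +ᶜ-cong (shift-shift (sq +ℕ sq) sp (sp +ℕ sq) sq P′ (xy∙z≈zy∙x sq sq sp)) ≋-refl ⟩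
    shift (sp +ℕ sq) (shift sq P′) +ᶜ shift (sp +ℕ sq) (shift sp′ Q)
      ≈⟨ shift-+ᶜ (sp +ℕ sq) (shift sq P′) (shift sp′ Q) ⟨
    shift (sp +ℕ sq) (shift sq P′ +ᶜ shift sp′ Q) ∎)
    where
    open ≋-Reasoning
    sp = sh p ; sp′ = sh p′ ; sq = sh q
    P = co p ; P′ = co p′ ; Q = co q

  addP-cong : ∀ {p p′ q q′} → p ≈ᴸ p′ → q ≈ᴸ q′ → addP p q ≈ᴸ addP p′ q′
  addP-cong {p} {p′} {q} {q′} p≈p′ q≈q′ =
    ≈ᴸ-trans (addP-congˡ q p≈p′) (≈ᴸ-trans (addP-comm p′ q) (≈ᴸ-trans (addP-congˡ p′ q≈q′) (addP-comm q′ p′)))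

  addP-assoc : ∀ p q r → addP (addP p q) r ≈ᴸ addP p (addP q r)
  addP-assoc p q r = ≈ᴸ-from-≋ (ℕ.+-assoc (sh p) (sh q) (sh r)) (begin
    shift sr (shift sq P +ᶜ shift sp Q) +ᶜ shift (sp +ℕ sq) R
      ≈⟨ +ᶜ-cong (shift-+ᶜ sr (shift sq P) (shift sp Q)) ≋-refl ⟩
    (shift sr (shift sq P) +ᶜ shift sr (shift sp Q)) +ᶜ shift (sp +ℕ sq) R
      ≈⟨ (λ m i → +-assoc _ _ _) ⟩
    shift sr (shift sq P) +ᶜ (shift sr (shift sp Q) +ᶜ shift (sp +ℕ sq) R)
      ≈⟨ +ᶜ-cong (shift-shift sr sq (sq +ℕ sr) 0 P (≡.trans (ℕ.+-comm sr sq) (≡.sym (ℕ.+-identityʳ _))))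
                 (+ᶜ-cong (shift-comm sr sp Q) (≋-sym (shift-+ sp sq R))) ⟩
    shift (sq +ℕ sr) P +ᶜ (shift sp (shift sr Q) +ᶜ shift sp (shift sq R))
      ≈⟨ +ᶜ-cong ≋-refl (shift-+ᶜ sp (shift sr Q) (shift sq R)) ⟨
    shift (sq +ℕ sr) P +ᶜ shift sp (shift sr Q +ᶜ shift sq R) ∎)
    where
    open ≋-Reasoning
    sp = sh p ; sq = sh q ; sr = sh r
    P = co p ; Q = co q ; R = co r

  addP-identityˡ : ∀ p → addP zeroP p ≈ᴸ p
  addP-identityˡ p = ≈ᴸ-from-≋ ≡.refl (λ m i → trans (+-congʳ (shift-0ᶜ (sh p) m i)) (+-identityˡ _))

  addP-inverseˡ : ∀ p → addP (negP p) p ≈ᴸ zeroP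
  addP-inverseˡ p = mk≈ᴸ (λ m i →
    trans (+-congʳ (shift-negᶜ (sh p) (co p) m i)) (trans (-‿inverseˡ _) (sym (shift-0ᶜ (sh p +ℕ sh p) m i))))

  negP-cong : ∀ {p q} → p ≈ᴸ q → negP p ≈ᴸ negP q
  negP-cong {p} {q} (mk≈ᴸ p≈q) = mk≈ᴸ (λ m i →
    trans (shift-negᶜ (sh q) (co p) m i) (trans (-‿cong (p≈q m i)) (sym (shift-negᶜ (sh p) (co q) m i))))

  mulP-comm : ∀ p q → mulP p q ≈ᴸ mulP q p
  mulP-comm p q = ≈ᴸ-from-≋ (ℕ.+-comm (sh p) (sh q)) (*ᶜ-comm (co p) (co q))

  mulP-assoc : ∀ p q r → mulP (mulP p q) r ≈ᴸ mulP p (mulP q r)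
  mulP-assoc p q r = ≈ᴸ-from-≋ (ℕ.+-assoc (sh p) (sh q) (sh r)) (*ᶜ-assoc (co p) (co q) (co r))

  mulP-identityˡ : ∀ p → mulP oneP p ≈ᴸ p
  mulP-identityˡ p = ≈ᴸ-from-≋ ≡.refl (*ᶜ-identityˡ (co p))

  mulP-congˡ : ∀ {p p′} q → p ≈ᴸ p′ → mulP p q ≈ᴸ mulP p′ q
  mulP-congˡ {p} {p′} q (mk≈ᴸ p≈p′) = mk≈ᴸ (begin
    shift (sp′ +ℕ sq) (P *ᶜ Q)      ≈⟨ shift-shift (sp′ +ℕ sq) 0 sq sp′ (P *ᶜ Q) (xy∙z≈zy∙x sp′ sq 0) ⟩
    shift sq (shift sp′ (P *ᶜ Q))   ≈⟨ shift-cong sq (shift-*ᶜ sp′ P Q) ⟩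
    shift sq (shift sp′ P *ᶜ Q)     ≈⟨ shift-cong sq (*ᶜ-cong p≈p′ (≋-refl {P = Q})) ⟩
    shift sq (shift sp P′ *ᶜ Q)     ≈⟨ shift-cong sq (shift-*ᶜ sp P′ Q) ⟨
    shift sq (shift sp (P′ *ᶜ Q))   ≈⟨ shift-shift sq sp (sp +ℕ sq) 0 (P′ *ᶜ Q) (≡.trans (ℕ.+-comm sq sp) (≡.sym (ℕ.+-identityʳ _))) ⟩
    shift (sp +ℕ sq) (P′ *ᶜ Q)      ∎)
    where
    open ≋-Reasoning
    sp = sh p ; sp′ = sh p′ ; sq = sh q
    P = co p ; P′ = co p′ ; Q = co q

  mulP-cong : ∀ {p p′ q q′} → p ≈ᴸ p′ → q ≈ᴸ q′ → mulP p q ≈ᴸ mulP p′ q′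
  mulP-cong {p} {p′} {q} {q′} p≈p′ q≈q′ =
    ≈ᴸ-trans (mulP-congˡ q p≈p′) (≈ᴸ-trans (mulP-comm p′ q) (≈ᴸ-trans (mulP-congˡ p′ q≈q′) (mulP-comm q′ p′)))

  mulP-distribˡ : ∀ p q r → mulP p (addP q r) ≈ᴸ addP (mulP p q) (mulP p r)
  mulP-distribˡ p q r = ≈ᴸ-common-shift (sh p) 0 (arith (sh p) (sh q) (sh r)) (begin
    shift sp (P *ᶜ (shift sr Q +ᶜ shift sq R))
      ≈⟨ shift-cong sp (*ᶜ-distribˡ P (shift sr Q) (shift sq R)) ⟩
    shift sp (P *ᶜ shift sr Q +ᶜ P *ᶜ shift sq R)
      ≈⟨ shift-+ᶜ sp (P *ᶜ shift sr Q) (P *ᶜ shift sq R) ⟩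
    shift sp (P *ᶜ shift sr Q) +ᶜ shift sp (P *ᶜ shift sq R)
      ≈⟨ +ᶜ-cong (shift-cong sp (shift-*ᶜʳ sr P Q)) (shift-cong sp (shift-*ᶜʳ sq P R)) ⟨
    shift sp (shift sr (P *ᶜ Q)) +ᶜ shift sp (shift sq (P *ᶜ R))
      ≈⟨ +ᶜ-cong (shift-+ sp sr (P *ᶜ Q)) (shift-+ sp sq (P *ᶜ R)) ⟩
    shift (sp +ℕ sr) (P *ᶜ Q) +ᶜ shift (sp +ℕ sq) (P *ᶜ R) ∎)
    where
    open ≋-Reasoning
    sp = sh p ; sq = sh q ; sr = sh r
    P = co p ; Q = co q ; R = co r
    arith : ∀ a b c → (a +ℕ (b +ℕ c)) +ℕ a ≡ ((a +ℕ b) +ℕ (a +ℕ c)) +ℕ 0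
    arith = solve-∀

  laurentRing : CommutativeRing c ℓ
  laurentRing = record
    { Carrier = LPoly n ; _≈_ = _≈ᴸ_ ; _+_ = addP ; _*_ = mulP ; -_ = negP ; 0# = zeroP ; 1# = oneP
    ; isCommutativeRing = record
      { isRing = record
        { +-isAbelianGroup = record
          { isGroup = record
            { isMonoid = record
              { isSemigroup = record
                { isMagma = record
                  { isEquivalence = record { refl = ≈ᴸ-refl ; sym = ≈ᴸ-sym ; trans = ≈ᴸ-trans }
                  ; ∙-cong = addP-cong }
                ; assoc = addP-assoc }
              ; identity = addP-identityˡ , λ p → ≈ᴸ-trans (addP-comm p zeroP) (addP-identityˡ p) }
            ; inverse = addP-inverseˡ , λ p → ≈ᴸ-trans (addP-comm p (negP p)) (addP-inverseˡ p)
            ; ⁻¹-cong = negP-cong }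
          ; comm = addP-comm }
        ; *-cong = mulP-cong
        ; *-assoc = mulP-assoc
        ; *-identity = mulP-identityˡ , λ p → ≈ᴸ-trans (mulP-comm p oneP) (mulP-identityˡ p)
        ; distrib = mulP-distribˡ , λ p q r →
            ≈ᴸ-trans (mulP-comm (addP q r) p) (≈ᴸ-trans (mulP-distribˡ p q r) (addP-cong (mulP-comm p q) (mulP-comm p r))) }
      ; *-comm = mulP-comm } }

module Coefficients {c ℓ} (F : Field c ℓ) (n : ℕ) where
  open Field F
  open WithField F
  open MultivariateSeries commutativeRing
  open EpsilonShift commutativeRing
  open LaurentPolynomials F n
  open SetoidReasoning setoid

  ≈ᴸ⇒shift-≈ : ∀ {p q : LPoly n} → p ≈ᴸ q →
               ∀ t m j → shift t (co p) m (j +ℕ sh p) ≈ shift t (co q) m (j +ℕ sh q)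
  ≈ᴸ⇒shift-≈ {p} {q} (mk≈ᴸ p≈q) t m j = begin
    shift t (co p) m (j +ℕ sh p)                       ≈⟨ shift-cancel (sh q) (shift t (co p)) m (j +ℕ sh p) ⟨
    shift (sh q) (shift t (co p)) m (j +ℕ sh p +ℕ sh q) ≈⟨ shift-comm (sh q) t (co p) m _ ⟩
    shift t (shift (sh q) (co p)) m (j +ℕ sh p +ℕ sh q) ≈⟨ shift-cong t p≈q m _ ⟩
    shift t (shift (sh p) (co q)) m (j +ℕ sh p +ℕ sh q) ≈⟨ shift-comm t (sh p) (co q) m _ ⟩
    shift (sh p) (shift t (co q)) m (j +ℕ sh p +ℕ sh q) ≡⟨ ≡.cong (shift (sh p) (shift t (co q)) m) (xy∙z≈xz∙y j _ _) ⟩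
    shift (sh p) (shift t (co q)) m (j +ℕ sh q +ℕ sh p) ≈⟨ shift-cancel (sh p) (shift t (co q)) m (j +ℕ sh q) ⟩
    shift t (co q) m (j +ℕ sh q)                       ∎

  coeffAt-negative : ∀ (p : LPoly n) m k → coeffAt p m -[1+ k ] ≈ shift (suc k) (co p) m (sh p)
  coeffAt-negative p m k rewrite <ᵇ-suc-flip k (sh p) with k <ᵇ sh p
  ... | true  = refl
  ... | false = refl

  coeffAt-cong : ∀ {p q : LPoly n} → p ≈ᴸ q → ∀ m d → coeffAt p m d ≈ coeffAt q m d
  coeffAt-cong p≈q m (+ k)    = ≈ᴸ⇒shift-≈ p≈q 0 m k
  coeffAt-cong {p} {q} p≈q m -[1+ k ] =
    trans (coeffAt-negative p m k) (trans (≈ᴸ⇒shift-≈ p≈q (suc k) m 0) (sym (coeffAt-negative q m k)))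

allZero⇒lookup≡0 : ∀ {k} (m : Monomial k) v → allZero m ≡ true → lookup m v ≡ 0
allZero⇒lookup≡0 (zero  ∷ m) zero    _  = ≡.refl
allZero⇒lookup≡0 (zero  ∷ m) (suc v) eq = allZero⇒lookup≡0 m v eq
allZero⇒lookup≡0 (suc _ ∷ m) v       ()

module VariableMultiplication {c ℓ} (R : CommutativeRing c ℓ) where
  open CommutativeRing R hiding (zero)
  open FiniteSums R
  open MultivariateSeries R
  open SetoidReasoning setoid

  -- coefficients of x_v · G
  mulByVar : ∀ {k} → Fin k → (Monomial k → Carrier) → Monomial k → Carrier
  mulByVar zero    G (zero  ∷ m) = 0#
  mulByVar zero    G (suc a ∷ m) = G (a ∷ m)
  mulByVar (suc v) G (a ∷ m)     = mulByVar v (λ m′ → G (a ∷ m′)) m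

  mulByVar-lookup≡0 : ∀ {k} (v : Fin k) G m → lookup m v ≡ 0 → mulByVar v G m ≈ 0#
  mulByVar-lookup≡0 zero    G (zero  ∷ m) _  = refl
  mulByVar-lookup≡0 zero    G (suc _ ∷ m) ()
  mulByVar-lookup≡0 (suc v) G (a ∷ m)     eq = mulByVar-lookup≡0 v (λ m′ → G (a ∷ m′)) m eq

  mulByVar-lookup≡suc : ∀ {k} (v : Fin k) G m a → lookup m v ≡ suc a → mulByVar v G m ≈ G (m [ v ]≔ a)
  mulByVar-lookup≡suc zero    G (zero  ∷ m) a ()
  mulByVar-lookup≡suc zero    G (suc _ ∷ m) a ≡.refl = refl
  mulByVar-lookup≡suc (suc v) G (b ∷ m)     a eq     = mulByVar-lookup≡suc v (λ m′ → G (b ∷ m′)) m a eq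

  mulByVar-zero : ∀ {k} (v : Fin k) G m → (∀ u → G u ≈ 0#) → mulByVar v G m ≈ 0#
  mulByVar-zero v G m G≈0 with lookup m v in eq
  ... | zero  = mulByVar-lookup≡0 v G m eq
  ... | suc a = trans (mulByVar-lookup≡suc v G m a eq) (G≈0 _)

  mulByVar-free : ∀ {k} (v w : Fin k) G m → w ≢ v → (∀ u → lookup u w ≢ 0 → G u ≈ 0#) → lookup m w ≢ 0 →
                  mulByVar v G m ≈ 0#
  mulByVar-free v w G m w≢v G-free m[w]≢0 with lookup m v in m[v]
  ... | zero  = mulByVar-lookup≡0 v G m m[v]
  ... | suc a = trans (mulByVar-lookup≡suc v G m a m[v])
                      (G-free (m [ v ]≔ a) (λ e → m[w]≢0 (≡.trans (≡.sym (lookup∘updateAt′ w v w≢v m)) e)))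

  mulByVarᶜ : ∀ {k} → Fin k → Coeffs k → Coeffs k
  mulByVarᶜ v P m i = mulByVar v (λ u → P u i) m

  mulByVarᶜ-+ᶜ-injective : ∀ {k} v (A A′ C C′ : Coeffs k) →
    (∀ m i → lookup m v ≢ 0 → C m i ≈ 0#) → (∀ m i → lookup m v ≢ 0 → C′ m i ≈ 0#) →
    mulByVarᶜ v A +ᶜ C ≋ mulByVarᶜ v A′ +ᶜ C′ → A ≋ A′ × C ≋ C′
  mulByVarᶜ-+ᶜ-injective v A A′ C C′ C-free C′-free eq = A≋A′ , C≋C′
    where
    C≋C′ : C ≋ C′
    C≋C′ m i with lookup m v in m[v]
    ... | zero = begin
      C m i                          ≈⟨ +-identityˡ _ ⟨
      0# + C m i                     ≈⟨ +-congʳ (mulByVar-lookup≡0 v _ m m[v]) ⟨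
      mulByVarᶜ v A m i + C m i      ≈⟨ eq m i ⟩
      mulByVarᶜ v A′ m i + C′ m i    ≈⟨ +-congʳ (mulByVar-lookup≡0 v _ m m[v]) ⟩
      0# + C′ m i                    ≈⟨ +-identityˡ _ ⟩
      C′ m i                         ∎
    ... | suc a = trans (C-free m i v≢0) (sym (C′-free m i v≢0))
      where
      v≢0 : lookup m v ≢ 0
      v≢0 v≡0 = ℕ.0≢1+n (≡.trans (≡.sym v≡0) m[v])
    A≋A′ : A ≋ A′
    A≋A′ u i = begin
      A u i                          ≈⟨ unshift A ⟨
      mulByVarᶜ v A m i              ≈⟨ +-identityʳ _ ⟨
      mulByVarᶜ v A m i + 0#         ≈⟨ +-congˡ (C-free m i v≢0) ⟨
      mulByVarᶜ v A m i + C m i      ≈⟨ eq m i ⟩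
      mulByVarᶜ v A′ m i + C′ m i    ≈⟨ +-congˡ (C′-free m i v≢0) ⟩
      mulByVarᶜ v A′ m i + 0#        ≈⟨ +-identityʳ _ ⟩
      mulByVarᶜ v A′ m i             ≈⟨ unshift A′ ⟩
      A′ u i                         ∎
      where
      m = u [ v ]≔ suc (lookup u v)
      m[v] : lookup m v ≡ suc (lookup u v)
      m[v] = lookup∘updateAt v u
      v≢0 : lookup m v ≢ 0
      v≢0 v≡0 = ℕ.0≢1+n (≡.trans (≡.sym v≡0) m[v])
      unshift : ∀ X → mulByVarᶜ v X m i ≈ X u i
      unshift X = trans (mulByVar-lookup≡suc v (λ w → X w i) m (lookup u v) m[v])
        (reflexive (≡.cong (λ w → X w i) (≡.trans ([]≔-idempotent u v) ([]≔-lookup u v))))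

  private
    ∑-pick-last : ∀ a (f : ℕ → Carrier) → ∑ (suc a) (λ k → if (a ∸ k) ≡ᵇ 0 then f k else 0#) ≈ f a
    ∑-pick-last a f =
      trans (∑-only-last a _ vanish) (reflexive (≡.cong (λ d → if d ≡ᵇ 0 then f a else 0#) (ℕ.n∸n≡0 a)))
      where
      vanish : ∀ j → j < a → (if (a ∸ j) ≡ᵇ 0 then f j else 0#) ≈ 0#
      vanish j j<a rewrite ℕ.+-∸-assoc 1 j<a = refl

    ∑-pick-penultimate : ∀ a (f : ℕ → Carrier) → ∑ (suc (suc a)) (λ k → if (suc a ∸ k) ≡ᵇ 1 then f k else 0#) ≈ f a
    ∑-pick-penultimate a f = begin
      ∑ (suc (suc a)) g        ≈⟨ ∑-snoc (suc a) g ⟩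
      ∑ (suc a) g + g (suc a)  ≡⟨ ≡.cong (λ d → ∑ (suc a) g + (if d ≡ᵇ 1 then f (suc a) else 0#)) (ℕ.n∸n≡0 a) ⟩
      ∑ (suc a) g + 0#         ≈⟨ +-identityʳ _ ⟩
      ∑ (suc a) g              ≈⟨ ∑-only-last a g vanish ⟩
      g a                      ≡⟨ ≡.cong (λ d → if d ≡ᵇ 1 then f a else 0#) a+1∸a≡1 ⟩
      f a                      ∎
      where
      g : ℕ → Carrier
      g k = if (suc a ∸ k) ≡ᵇ 1 then f k else 0#
      vanish : ∀ j → j < a → g j ≈ 0#
      vanish j j<a rewrite ℕ.+-∸-assoc 1 (ℕ.m<n⇒m<1+n j<a) | ℕ.+-∸-assoc 1 j<a = refl
      a+1∸a≡1 : suc a ∸ a ≡ 1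
      a+1∸a≡1 = ≡.trans (ℕ.+-∸-assoc 1 (ℕ.n<1+n a)) (≡.cong suc (ℕ.n∸n≡0 a))

  ι : Bool → Carrier
  ι b = if b then 1# else 0#

  sum-splits-allZero : ∀ {k} (H : Monomial k → Carrier) m →
                       sum (map (λ uv → H (proj₁ uv) * ι (allZero (proj₂ uv))) (splits m)) ≈ H m
  sum-splits-allZero H []      = trans (+-identityʳ _) (*-identityʳ _)
  sum-splits-allZero H (a ∷ m) =
    trans (sum-splits-∷ a m _) (trans (∑-cong (suc a) step) (∑-pick-last a (λ k → H (k ∷ m))))
    where
    step : ∀ k → sum (map (λ uv → H (k ∷ proj₁ uv) * ι (((a ∸ k) ≡ᵇ 0) ∧ allZero (proj₂ uv))) (splits m))
                 ≈ (if (a ∸ k) ≡ᵇ 0 then H (k ∷ m) else 0#)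
    step k with (a ∸ k) ≡ᵇ 0
    ... | true  = sum-splits-allZero (λ u → H (k ∷ u)) m
    ... | false = sum-map-zero (splits m) (λ uv → zeroʳ _)

  sum-splits-isUnit : ∀ {k} (v : Fin k) (G : Monomial k → Carrier) m →
                      sum (map (λ uv → G (proj₁ uv) * ι (isUnit v (proj₂ uv))) (splits m)) ≈ mulByVar v G m
  sum-splits-isUnit zero G (a ∷ m) = trans (sum-splits-∷ a m _) (trans (∑-cong (suc a) step) (pick a))
    where
    step : ∀ k → sum (map (λ uv → G (k ∷ proj₁ uv) * ι (((a ∸ k) ≡ᵇ 1) ∧ allZero (proj₂ uv))) (splits m))
                 ≈ (if (a ∸ k) ≡ᵇ 1 then G (k ∷ m) else 0#)
    step k with (a ∸ k) ≡ᵇ 1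
    ... | true  = sum-splits-allZero (λ u → G (k ∷ u)) m
    ... | false = sum-map-zero (splits m) (λ uv → zeroʳ _)
    pick : ∀ a → ∑ (suc a) (λ k → if (a ∸ k) ≡ᵇ 1 then G (k ∷ m) else 0#) ≈ mulByVar zero G (a ∷ m)
    pick zero    = +-identityˡ 0#
    pick (suc a) = ∑-pick-penultimate a (λ k → G (k ∷ m))
  sum-splits-isUnit (suc v) G (a ∷ m) =
    trans (sum-splits-∷ a m _) (trans (∑-cong (suc a) step) (∑-pick-last a (λ k → mulByVar v (λ u → G (k ∷ u)) m)))
    where
    step : ∀ k → sum (map (λ uv → G (k ∷ proj₁ uv) * ι (((a ∸ k) ≡ᵇ 0) ∧ isUnit v (proj₂ uv))) (splits m))
                 ≈ (if (a ∸ k) ≡ᵇ 0 then mulByVar v (λ u → G (k ∷ u)) m else 0#)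
    step k with (a ∸ k) ≡ᵇ 0
    ... | true  = sum-splits-isUnit v (λ u → G (k ∷ u)) m
    ... | false = sum-map-zero (splits m) (λ uv → zeroʳ _)

module PolynomialIdentity {c ℓ} (F : Field c ℓ) (n : ℕ) where
  open Field F hiding (zero)
  open import Algebra.Properties.Ring ring using (-‿distribˡ-*)
  open WithField F
  open FiniteSums commutativeRing
  open PowerSeries commutativeRing using (scaleₛ-*ₛ)
  open MultivariateSeries commutativeRing
  open EpsilonShift commutativeRing using (shift; module ≋-Reasoning)
  open VariableMultiplication commutativeRing
  open LaurentPolynomials F n
  open Coefficients F n
  private module L = CommutativeRing laurentRing

  κ : Carrier → LPoly n
  κ a = constP (fromF a)

  private
    scaleᶜ : Carrier → Coeffs n → Coeffs n
    scaleᶜ a P m i = a * P m i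

    scaleᶜ-*ᶜ : ∀ a P Q → scaleᶜ a P *ᶜ Q ≋ scaleᶜ a (P *ᶜ Q)
    scaleᶜ-*ᶜ a P Q m i = begin
      (scaleᶜ a P *ᶜ Q) m i
        ≈⟨ *ᶜ-as-sum (scaleᶜ a P) Q m i ⟩
      sum (map (λ uv → ∑ (suc i) (λ j → (a * P (proj₁ uv) j) * Q (proj₂ uv) (i ∸ j))) (splits m))
        ≈⟨ sum-map-cong (splits m) (λ uv → scaleₛ-*ₛ a (P (proj₁ uv)) (Q (proj₂ uv)) i) ⟩
      sum (map (λ uv → a * ∑ (suc i) (λ j → P (proj₁ uv) j * Q (proj₂ uv) (i ∸ j))) (splits m))
        ≈⟨ sum-map-*ˡ a _ (splits m) ⟨
      a * sum (map (λ uv → ∑ (suc i) (λ j → P (proj₁ uv) j * Q (proj₂ uv) (i ∸ j))) (splits m))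
        ≈⟨ *-congˡ (*ᶜ-as-sum P Q m i) ⟨
      scaleᶜ a (P *ᶜ Q) m i ∎
      where open SetoidReasoning setoid

    κ≋scaleᶜ : ∀ a → co (κ a) ≋ scaleᶜ a 1ᶜ
    κ≋scaleᶜ a m i with allZero m
    κ≋scaleᶜ a m zero    | true  = sym (*-identityʳ a)
    κ≋scaleᶜ a m (suc i) | true  = sym (zeroʳ a)
    ...                  | false = sym (zeroʳ a)

  κ-+ : ∀ a b → κ (a + b) ≈ᴸ addP (κ a) (κ b)
  κ-+ a b = ≈ᴸ-from-≋ ≡.refl (≋-trans (κ≋scaleᶜ (a + b))
    (≋-trans (λ m i → distribʳ (1ᶜ m i) a b) (+ᶜ-cong (≋-sym (κ≋scaleᶜ a)) (≋-sym (κ≋scaleᶜ b)))))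

  κ-* : ∀ a b → κ (a * b) ≈ᴸ mulP (κ a) (κ b)
  κ-* a b = ≈ᴸ-from-≋ ≡.refl (begin
    co (κ (a * b))               ≈⟨ κ≋scaleᶜ (a * b) ⟩
    scaleᶜ (a * b) 1ᶜ            ≈⟨ (λ m i → *-assoc a b (1ᶜ m i)) ⟩
    scaleᶜ a (scaleᶜ b 1ᶜ)       ≈⟨ (λ m i → *-congˡ (κ≋scaleᶜ b m i)) ⟨
    scaleᶜ a (co (κ b))          ≈⟨ (λ m i → *-congˡ (*ᶜ-identityˡ (co (κ b)) m i)) ⟨
    scaleᶜ a (1ᶜ *ᶜ co (κ b))    ≈⟨ scaleᶜ-*ᶜ a 1ᶜ (co (κ b)) ⟨
    scaleᶜ a 1ᶜ *ᶜ co (κ b)      ≈⟨ *ᶜ-cong (κ≋scaleᶜ a) (≋-refl {P = co (κ b)}) ⟨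
    co (κ a) *ᶜ co (κ b)         ∎)
    where open ≋-Reasoning

  κ-neg : ∀ a → κ (- a) ≈ᴸ negP (κ a)
  κ-neg a = ≈ᴸ-from-≋ ≡.refl (≋-trans (κ≋scaleᶜ (- a))
    (≋-trans (λ m i → sym (-‿distribˡ-* a (1ᶜ m i))) (λ m i → -‿cong (sym (κ≋scaleᶜ a m i)))))

  κ-0 : κ 0# ≈ᴸ zeroP
  κ-0 = ≈ᴸ-from-≋ ≡.refl (≋-trans (κ≋scaleᶜ 0#) (λ m i → zeroˡ (1ᶜ m i)))

  κ-1 : κ 1# ≈ᴸ oneP
  κ-1 = ≈ᴸ-from-≋ ≡.refl (≋-trans (κ≋scaleᶜ 1#) (λ m i → *-identityˡ (1ᶜ m i)))

  laurentACR : AlmostCommutativeRing c ℓ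
  laurentACR = fromCommutativeRing laurentRing

  κ-morphism : rawRing -Raw-AlmostCommutative⟶ laurentACR
  κ-morphism = record
    { ⟦_⟧ = κ ; +-homo = κ-+ ; *-homo = κ-* ; -‿homo = κ-neg ; 0-homo = κ-0 ; 1-homo = κ-1 }

  module Solver = RingSolver rawRing laurentACR κ-morphism (λ _ _ → nothing)
  open Solver using (Polynomial; Normal; HNF; con; poly; ∅; _*x+_; ⟦_⟧; ⟦_⟧N; ⟦_⟧H; normalise)

  toPolynomial : Expr Carrier n → Polynomial n
  toPolynomial (var x)  = Solver.var x
  toPolynomial (con a)  = Solver.con a
  toPolynomial (e ⊕ e′) = toPolynomial e Solver.:+ toPolynomial e′
  toPolynomial (e ⊗ e′) = toPolynomial e Solver.:* toPolynomial e′

  evalE≈⟦toPolynomial⟧ : ∀ (ρ : Fin n → LPoly n) e → evalE fromF ρ e ≈ᴸ ⟦ toPolynomial e ⟧ (tabulate ρ)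
  evalE≈⟦toPolynomial⟧ ρ (var x)  = L.reflexive (≡.sym (lookup∘tabulate ρ x))
  evalE≈⟦toPolynomial⟧ ρ (con a)  = ≈ᴸ-refl
  evalE≈⟦toPolynomial⟧ ρ (e ⊕ e′) = addP-cong (evalE≈⟦toPolynomial⟧ ρ e) (evalE≈⟦toPolynomial⟧ ρ e′)
  evalE≈⟦toPolynomial⟧ ρ (e ⊗ e′) = mulP-cong (evalE≈⟦toPolynomial⟧ ρ e) (evalE≈⟦toPolynomial⟧ ρ e′)

  *ᶜ-varP : ∀ v (P : Coeffs n) → P *ᶜ co (varP v) ≋ mulByVarᶜ v P
  *ᶜ-varP v P m i = begin
    (P *ᶜ X) m i
      ≈⟨ *ᶜ-as-sum P X m i ⟩
    sum (map (λ uv → ∑ (suc i) (λ j → P (proj₁ uv) j * X (proj₂ uv) (i ∸ j))) (splits m))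
      ≈⟨ sum-map-cong (splits m) only-last ⟩
    sum (map (λ uv → P (proj₁ uv) i * ι (isUnit v (proj₂ uv))) (splits m))
      ≈⟨ sum-splits-isUnit v (λ u → P u i) m ⟩
    mulByVarᶜ v P m i ∎
    where
    open SetoidReasoning setoid
    X = co (varP {n} v)
    only-last : ∀ uv → ∑ (suc i) (λ j → P (proj₁ uv) j * X (proj₂ uv) (i ∸ j)) ≈ P (proj₁ uv) i * ι (isUnit v (proj₂ uv))
    only-last (u , w) = trans (∑-only-last i _ vanish) (reflexive (≡.cong (λ d → P u i * X w d) (ℕ.n∸n≡0 i)))
      where
      vanish : ∀ j → j < i → P u j * X w (i ∸ j) ≈ 0#
      vanish j j<i rewrite ℕ.+-∸-assoc 1 j<i = zeroʳ _

  -- Variable j of a normal form is read as x_(σ j).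
  mutual
    coeffsᴺ : ∀ {k} → (Fin k → Fin n) → Normal k → Coeffs n
    coeffsᴺ σ (con a)  = co (κ a)
    coeffsᴺ σ (poly p) = coeffsᴴ σ p

    coeffsᴴ : ∀ {k} → (Fin (suc k) → Fin n) → HNF (suc k) → Coeffs n
    coeffsᴴ σ ∅         = 0ᶜ
    coeffsᴴ σ (p *x+ c) = mulByVarᶜ (σ zero) (coeffsᴴ σ p) +ᶜ coeffsᴺ (σ ∘ suc) c

  mutual
    ⟦⟧N-at-vars : ∀ {k} (σ : Fin k → Fin n) N → ⟦ N ⟧N (tabulate (varP ∘ σ)) ≈ᴸ lpoly 0 (coeffsᴺ σ N)
    ⟦⟧N-at-vars σ (con a)  = ≈ᴸ-refl
    ⟦⟧N-at-vars σ (poly p) = ⟦⟧H-at-vars σ p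

    ⟦⟧H-at-vars : ∀ {k} (σ : Fin (suc k) → Fin n) p → ⟦ p ⟧H (tabulate (varP ∘ σ)) ≈ᴸ lpoly 0 (coeffsᴴ σ p)
    ⟦⟧H-at-vars σ ∅         = ≈ᴸ-refl
    ⟦⟧H-at-vars σ (p *x+ c) =
      ≈ᴸ-trans (addP-cong (mulP-cong (⟦⟧H-at-vars σ p) ≈ᴸ-refl) (⟦⟧N-at-vars (σ ∘ suc) c))
               (≈ᴸ-from-≋ ≡.refl (+ᶜ-cong (*ᶜ-varP (σ zero) (coeffsᴴ σ p)) ≋-refl))

  mutual
    coeffsᴺ-ε-constant : ∀ {k} σ (N : Normal k) m i → coeffsᴺ σ N m (suc i) ≈ 0#
    coeffsᴺ-ε-constant σ (con a)  m i with allZero m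
    ... | true  = refl
    ... | false = refl
    coeffsᴺ-ε-constant σ (poly p) m i = coeffsᴴ-ε-constant σ p m i

    coeffsᴴ-ε-constant : ∀ {k} σ (p : HNF (suc k)) m i → coeffsᴴ σ p m (suc i) ≈ 0#
    coeffsᴴ-ε-constant σ ∅         m i = refl
    coeffsᴴ-ε-constant σ (p *x+ c) m i = trans
      (+-cong (mulByVar-zero (σ zero) _ m (λ u → coeffsᴴ-ε-constant σ p u i)) (coeffsᴺ-ε-constant (σ ∘ suc) c m i))
      (+-identityˡ 0#)

  mutual
    coeffsᴺ-free : ∀ {k} σ (N : Normal k) v → (∀ j → σ j ≢ v) → ∀ m i → lookup m v ≢ 0 → coeffsᴺ σ N m i ≈ 0#
    coeffsᴺ-free σ (con a)  v σ≢v m i v≢0 with allZero m in eq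
    ... | true  = ⊥-elim (v≢0 (allZero⇒lookup≡0 m v eq))
    ... | false = refl
    coeffsᴺ-free σ (poly p) v σ≢v m i v≢0 = coeffsᴴ-free σ p v σ≢v m i v≢0

    coeffsᴴ-free : ∀ {k} σ (p : HNF (suc k)) v → (∀ j → σ j ≢ v) → ∀ m i → lookup m v ≢ 0 → coeffsᴴ σ p m i ≈ 0#
    coeffsᴴ-free σ ∅         v σ≢v m i v≢0 = refl
    coeffsᴴ-free σ (p *x+ c) v σ≢v m i v≢0 = trans
      (+-cong (mulByVar-free (σ zero) v (λ u → coeffsᴴ σ p u i) m (σ≢v zero ∘ ≡.sym)
                             (λ u → coeffsᴴ-free σ p v σ≢v u i) v≢0)
              (coeffsᴺ-free (σ ∘ suc) c v (σ≢v ∘ suc) m i v≢0))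
      (+-identityˡ 0#)

  private
    tail-avoids-head : ∀ {k} (σ : Fin (suc k) → Fin n) → Injective _≡_ _≡_ σ → ∀ j → σ (suc j) ≢ σ zero
    tail-avoids-head σ σ-inj j eq with σ-inj eq
    ... | ()

    coeffsᴴ-*x+-injective : ∀ {k} (σ : Fin (suc k) → Fin n) → Injective _≡_ _≡_ σ → ∀ p c A C →
            coeffsᴴ σ (p *x+ c) ≋ mulByVarᶜ (σ zero) A +ᶜ C →
            (∀ m i → lookup m (σ zero) ≢ 0 → C m i ≈ 0#) →
            coeffsᴴ σ p ≋ A × coeffsᴺ (σ ∘ suc) c ≋ C
    coeffsᴴ-*x+-injective σ σ-inj p c A C eq C-free = mulByVarᶜ-+ᶜ-injective (σ zero) _ A _ C
      (coeffsᴺ-free (σ ∘ suc) c (σ zero) (tail-avoids-head σ σ-inj)) C-free eq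

  mutual
    coeffsᴺ≋0⇒⟦⟧≈0 : ∀ {k} σ (N : Normal k) → Injective _≡_ _≡_ σ → coeffsᴺ σ N ≋ 0ᶜ → ∀ ρ → ⟦ N ⟧N ρ ≈ᴸ zeroP
    coeffsᴺ≋0⇒⟦⟧≈0 σ (con a)  σ-inj N≋0 ρ = ≈ᴸ-from-≋ ≡.refl N≋0
    coeffsᴺ≋0⇒⟦⟧≈0 σ (poly p) σ-inj N≋0 ρ = coeffsᴴ≋0⇒⟦⟧≈0 σ p σ-inj N≋0 ρ

    coeffsᴴ≋0⇒⟦⟧≈0 : ∀ {k} σ (p : HNF (suc k)) → Injective _≡_ _≡_ σ → coeffsᴴ σ p ≋ 0ᶜ → ∀ ρ → ⟦ p ⟧H ρ ≈ᴸ zeroP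
    coeffsᴴ≋0⇒⟦⟧≈0 σ ∅         σ-inj p≋0 ρ       = ≈ᴸ-refl
    coeffsᴴ≋0⇒⟦⟧≈0 σ (p *x+ c) σ-inj p≋0 (x ∷ ρ) = begin
      addP (mulP (⟦ p ⟧H (x ∷ ρ)) x) (⟦ c ⟧N ρ)
        ≈⟨ L.+-cong (L.*-congʳ (coeffsᴴ≋0⇒⟦⟧≈0 σ p σ-inj (proj₁ parts) (x ∷ ρ)))
                    (coeffsᴺ≋0⇒⟦⟧≈0 (σ ∘ suc) c (suc-injective ∘ σ-inj) (proj₂ parts) ρ) ⟩
      addP (mulP zeroP x) zeroP ≈⟨ L.+-identityʳ _ ⟩
      mulP zeroP x              ≈⟨ L.zeroˡ x ⟩
      zeroP                     ∎
      where
      open SetoidReasoning L.setoid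
      parts = coeffsᴴ-*x+-injective σ σ-inj p c 0ᶜ 0ᶜ
        (λ m i → trans (p≋0 m i) (sym (trans (+-identityʳ _) (mulByVar-zero (σ zero) _ m (λ _ → refl)))))
        (λ _ _ _ → refl)

  -- Horner normal forms are not unique (∅ versus ∅ *x+ con 0#), but they are
  -- determined up to evaluation by their coefficient arrays.
  mutual
    coeffsᴺ-injective : ∀ {k} σ (N₁ N₂ : Normal k) → Injective _≡_ _≡_ σ → coeffsᴺ σ N₁ ≋ coeffsᴺ σ N₂ →
                        ∀ ρ → ⟦ N₁ ⟧N ρ ≈ᴸ ⟦ N₂ ⟧N ρ
    coeffsᴺ-injective σ (con a)   (con b)   σ-inj eq ρ = ≈ᴸ-from-≋ ≡.refl eq
    coeffsᴺ-injective σ (poly p₁) (poly p₂) σ-inj eq ρ = coeffsᴴ-injective σ p₁ p₂ σ-inj eq ρ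

    coeffsᴴ-injective : ∀ {k} σ (p₁ p₂ : HNF (suc k)) → Injective _≡_ _≡_ σ → coeffsᴴ σ p₁ ≋ coeffsᴴ σ p₂ →
                        ∀ ρ → ⟦ p₁ ⟧H ρ ≈ᴸ ⟦ p₂ ⟧H ρ
    coeffsᴴ-injective σ ∅           ∅           σ-inj eq ρ = ≈ᴸ-refl
    coeffsᴴ-injective σ ∅           (p *x+ c)   σ-inj eq ρ = ≈ᴸ-sym (coeffsᴴ≋0⇒⟦⟧≈0 σ (p *x+ c) σ-inj (≋-sym eq) ρ)
    coeffsᴴ-injective σ (p *x+ c)   ∅           σ-inj eq ρ = coeffsᴴ≋0⇒⟦⟧≈0 σ (p *x+ c) σ-inj eq ρ
    coeffsᴴ-injective σ (p₁ *x+ c₁) (p₂ *x+ c₂) σ-inj eq (x ∷ ρ) =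
      addP-cong (mulP-cong (coeffsᴴ-injective σ p₁ p₂ σ-inj (proj₁ parts) (x ∷ ρ)) (≈ᴸ-refl {x}))
                (coeffsᴺ-injective (σ ∘ suc) c₁ c₂ (suc-injective ∘ σ-inj) (proj₂ parts) ρ)
      where
      parts = coeffsᴴ-*x+-injective σ σ-inj p₁ c₁ (coeffsᴴ σ p₂) (coeffsᴺ (σ ∘ suc) c₂) eq
        (coeffsᴺ-free (σ ∘ suc) c₂ (σ zero) (tail-avoids-head σ σ-inj))

  evalE-cong-coeffs : ∀ (e₁ e₂ : Expr Carrier n) → (∀ m → coeffAt ⟦ e₁ ⟧F m (+ 0) ≈ coeffAt ⟦ e₂ ⟧F m (+ 0)) →
                      ∀ ρ → evalE fromF ρ e₁ ≈ᴸ evalE fromF ρ e₂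
  evalE-cong-coeffs e₁ e₂ same-coeffs ρ = begin
    evalE fromF ρ e₁                  ≈⟨ evalE≈⟦toPolynomial⟧ ρ e₁ ⟩
    ⟦ toPolynomial e₁ ⟧ (tabulate ρ)  ≈⟨ Solver.correct (toPolynomial e₁) (tabulate ρ) ⟨
    ⟦ normalForm e₁ ⟧N (tabulate ρ)   ≈⟨ coeffsᴺ-injective id N₁ N₂ id same-normal-coeffs (tabulate ρ) ⟩
    ⟦ normalForm e₂ ⟧N (tabulate ρ)   ≈⟨ Solver.correct (toPolynomial e₂) (tabulate ρ) ⟩
    ⟦ toPolynomial e₂ ⟧ (tabulate ρ)  ≈⟨ evalE≈⟦toPolynomial⟧ ρ e₂ ⟨
    evalE fromF ρ e₂                  ∎
    where
    open SetoidReasoning L.setoid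
    normalForm : Expr Carrier n → Normal n
    normalForm e = normalise (toPolynomial e)
    N₁ = normalForm e₁
    N₂ = normalForm e₂
    ⟦⟧F≈coeffs : ∀ e → ⟦ e ⟧F ≈ᴸ lpoly 0 (coeffsᴺ id (normalForm e))
    ⟦⟧F≈coeffs e = ≈ᴸ-trans (evalE≈⟦toPolynomial⟧ varP e)
      (≈ᴸ-trans (≈ᴸ-sym (Solver.correct (toPolynomial e) (tabulate varP))) (⟦⟧N-at-vars id (normalForm e)))
    same-normal-coeffs : coeffsᴺ id N₁ ≋ coeffsᴺ id N₂
    same-normal-coeffs m zero    = trans (sym (coeffAt-cong (⟦⟧F≈coeffs e₁) m (+ 0)))
                                     (trans (same-coeffs m) (coeffAt-cong (⟦⟧F≈coeffs e₂) m (+ 0)))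
    same-normal-coeffs m (suc i) = trans (coeffsᴺ-ε-constant id N₁ m i) (sym (coeffsᴺ-ε-constant id N₂ m i))

module Approximation {c ℓ} (F : Field c ℓ) (n : ℕ) where
  open Field F hiding (zero)
  open WithField F
  open MultivariateSeries commutativeRing
  open EpsilonShift commutativeRing
  open LaurentPolynomials F n
  open Coefficients F n using (coeffAt-cong)
  private module L = CommutativeRing laurentRing
  open CommutativeSemigroupProperties L.+-commutativeSemigroup using (interchange)

  ε^_·_ : ℕ → Coeffs n → LPoly n
  ε^ t · X = lpoly 0 (shift t X)

  infix 4 _≈ᴸ_mod[ε^_]
  record _≈ᴸ_mod[ε^_] (x y : LPoly n) (t : ℕ) : Set (c ⊔ ℓ) where
    constructor _,_
    field
      remainder  : Coeffs n
      ≈+ε^·remainder : x ≈ᴸ addP y (ε^ t · remainder)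

  record PoleOrder≤ (a : ℕ) (x : LPoly n) : Set (c ⊔ ℓ) where
    constructor _,_
    field
      numerator : Coeffs n
      ≈ε^-a·numerator : x ≈ᴸ lpoly a numerator

  private
    ε^·-+ᶜ : ∀ t X Y → addP (ε^ t · X) (ε^ t · Y) ≈ᴸ ε^ t · (X +ᶜ Y)
    ε^·-+ᶜ t X Y = ≈ᴸ-from-≋ ≡.refl (≋-sym (shift-+ᶜ t X Y))

    ε^·-mulP : ∀ t a X Y → mulP (ε^ (t +ℕ a) · X) (lpoly a Y) ≈ᴸ ε^ t · (X *ᶜ Y)
    ε^·-mulP t a X Y = mk≈ᴸ (≋-trans (≋-sym (shift-*ᶜ (t +ℕ a) X Y))
                                     (shift-shift 0 (t +ℕ a) a t (X *ᶜ Y) (ℕ.+-comm t a)))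

    lpoly-+ᶜ : ∀ a X Y → addP (lpoly a X) (lpoly a Y) ≈ᴸ lpoly a (X +ᶜ Y)
    lpoly-+ᶜ a X Y = mk≈ᴸ (≋-trans (shift-+ᶜ a (shift a X) (shift a Y))
      (≋-trans (+ᶜ-cong (shift-+ a a X) (shift-+ a a Y)) (≋-sym (shift-+ᶜ (a +ℕ a) X Y))))

  mod-refl : ∀ t x → x ≈ᴸ x mod[ε^ t ]
  mod-refl t x = 0ᶜ , L.sym (L.trans (L.+-congˡ {x} (≈ᴸ-from-≋ ≡.refl (shift-0ᶜ t))) (L.+-identityʳ x))

  mod-respˡ : ∀ {t x x′ y} → x ≈ᴸ x′ → x′ ≈ᴸ y mod[ε^ t ] → x ≈ᴸ y mod[ε^ t ]
  mod-respˡ x≈x′ (X , x′≈y+εX) = X , L.trans x≈x′ x′≈y+εX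

  mod-weaken : ∀ {u t x y} → x ≈ᴸ y mod[ε^ u ] → t ≤ u → x ≈ᴸ y mod[ε^ t ]
  mod-weaken {u} {t} {x} {y} (X , x≈y+εX) t≤u =
    shift (u ∸ t) X , L.trans x≈y+εX (L.+-congˡ {y} (≈ᴸ-from-≋ ≡.refl (λ m i →
      trans (reflexive (≡.cong (λ k → shift k X m i) (≡.sym (ℕ.m+[n∸m]≡n t≤u)))) (sym (shift-+ t (u ∸ t) X m i)))))

  mod-addP : ∀ {t x y x′ y′} → x ≈ᴸ y mod[ε^ t ] → x′ ≈ᴸ y′ mod[ε^ t ] → addP x x′ ≈ᴸ addP y y′ mod[ε^ t ]
  mod-addP {t} {x} {y} {x′} {y′} (X , x≈y+εX) (X′ , x′≈y′+εX′) = X +ᶜ X′ , (begin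
    addP x x′                                                ≈⟨ L.+-cong x≈y+εX x′≈y′+εX′ ⟩
    addP (addP y (ε^ t · X)) (addP y′ (ε^ t · X′))           ≈⟨ interchange y (ε^ t · X) y′ (ε^ t · X′) ⟩
    addP (addP y y′) (addP (ε^ t · X) (ε^ t · X′))           ≈⟨ L.+-congˡ {addP y y′} (ε^·-+ᶜ t X X′) ⟩
    addP (addP y y′) (ε^ t · (X +ᶜ X′))                      ∎)
    where open SetoidReasoning L.setoid

  -- x x′ = y y′ + ε^(t+a) (X y′ + x X′), and the poles of order ≤ a of y′ and x
  -- use up a of the t + a powers of ε.
  mod-mulP : ∀ {t a x y x′ y′} → x ≈ᴸ y mod[ε^ t +ℕ a ] → x′ ≈ᴸ y′ mod[ε^ t +ℕ a ] →
             PoleOrder≤ a x → PoleOrder≤ a y′ → mulP x x′ ≈ᴸ mulP y y′ mod[ε^ t ]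
  mod-mulP {t} {a} {x} {y} {x′} {y′} (X , x≈y+εX) (X′ , x′≈y′+εX′) (A , x≈A) (B′ , y′≈B′) =
    X *ᶜ B′ +ᶜ X′ *ᶜ A , (begin
    mulP x x′
      ≈⟨ L.*-congˡ {x} x′≈y′+εX′ ⟩
    mulP x (addP y′ εX′)
      ≈⟨ L.distribˡ x y′ εX′ ⟩
    addP (mulP x y′) (mulP x εX′)
      ≈⟨ L.+-congʳ {mulP x εX′} (L.*-congʳ {y′} x≈y+εX) ⟩
    addP (mulP (addP y εX) y′) (mulP x εX′)
      ≈⟨ L.+-congʳ {mulP x εX′} (L.distribʳ y′ y εX) ⟩
    addP (addP (mulP y y′) (mulP εX y′)) (mulP x εX′)
      ≈⟨ L.+-assoc (mulP y y′) (mulP εX y′) (mulP x εX′) ⟩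
    addP (mulP y y′) (addP (mulP εX y′) (mulP x εX′))
      ≈⟨ L.+-congˡ {mulP y y′} (L.+-cong εX·y′ x·εX′) ⟩
    addP (mulP y y′) (addP (ε^ t · (X *ᶜ B′)) (ε^ t · (X′ *ᶜ A)))
      ≈⟨ L.+-congˡ {mulP y y′} (ε^·-+ᶜ t (X *ᶜ B′) (X′ *ᶜ A)) ⟩
    addP (mulP y y′) (ε^ t · (X *ᶜ B′ +ᶜ X′ *ᶜ A))
      ∎)
    where
    open SetoidReasoning L.setoid
    εX  = ε^ (t +ℕ a) · X
    εX′ = ε^ (t +ℕ a) · X′
    εX·y′ : mulP εX y′ ≈ᴸ ε^ t · (X *ᶜ B′)
    εX·y′ = L.trans (L.*-congˡ {εX} y′≈B′) (ε^·-mulP t a X B′)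
    x·εX′ : mulP x εX′ ≈ᴸ ε^ t · (X′ *ᶜ A)
    x·εX′ = L.trans (L.*-comm x εX′) (L.trans (L.*-congˡ {εX′} x≈A) (ε^·-mulP t a X′ A))

  poleOrder≤-sh : ∀ x → PoleOrder≤ (sh x) x
  poleOrder≤-sh x = co x , ≈ᴸ-refl

  poleOrder≤-weaken : ∀ {a b x} → PoleOrder≤ a x → a ≤ b → PoleOrder≤ b x
  poleOrder≤-weaken {a} {b} (X , x≈X) a≤b = shift (b ∸ a) X , L.trans x≈X (mk≈ᴸ (λ m i →
    trans (reflexive (≡.cong (λ k → shift k X m i) (≡.sym (ℕ.m+[n∸m]≡n a≤b)))) (sym (shift-+ a (b ∸ a) X m i))))

  poleOrder≤-addP : ∀ {a x y} → PoleOrder≤ a x → PoleOrder≤ a y → PoleOrder≤ a (addP x y)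
  poleOrder≤-addP {a} (X , x≈X) (Y , y≈Y) = X +ᶜ Y , L.trans (L.+-cong x≈X y≈Y) (lpoly-+ᶜ a X Y)

  poleOrder≤-mulP : ∀ {a b x y} → PoleOrder≤ a x → PoleOrder≤ b y → PoleOrder≤ (a +ℕ b) (mulP x y)
  poleOrder≤-mulP (X , x≈X) (Y , y≈Y) = X *ᶜ Y , L.*-cong x≈X y≈Y

  private
    coeffAt-+ε-0 : ∀ p X m → coeffAt (addP p (ε^ 1 · X)) m (+ 0) ≈ coeffAt p m (+ 0)
    coeffAt-+ε-0 p X m rewrite ℕ.+-identityʳ (sh p) | n<ᵇn≡false (sh p) | ℕ.n∸n≡0 (sh p) = +-identityʳ _

    coeffAt-+ε-negative : ∀ p X m k → coeffAt (addP p (ε^ 1 · X)) m -[1+ k ] ≈ coeffAt p m -[1+ k ]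
    coeffAt-+ε-negative p X m k rewrite ℕ.+-identityʳ (sh p) with k <ᵇ sh p in k<sh
    ... | true rewrite <⇒<ᵇ≡true (ℕ.∸-monoʳ-< {sh p} {suc k} {0} (s≤s z≤n) (<ᵇ≡true⇒< k<sh)) = +-identityʳ _
    ... | false = refl

  mod-ε¹⇒coeffAt≈ : ∀ {x y} → x ≈ᴸ y mod[ε^ 1 ] → ∀ m →
    (∀ k → coeffAt x m -[1+ k ] ≈ coeffAt y m -[1+ k ]) × (coeffAt x m (+ 0) ≈ coeffAt y m (+ 0))
  mod-ε¹⇒coeffAt≈ {x} {y} (X , x≈y+εX) m =
    (λ k → trans (coeffAt-cong x≈y+εX m -[1+ k ]) (coeffAt-+ε-negative y X m k)) ,
    trans (coeffAt-cong x≈y+εX m (+ 0)) (coeffAt-+ε-0 y X m)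

  constP-mod : ∀ t (s s′ : Series) → (∀ i → i < t → s i ≈ s′ i) →
               constP (laurent 0 s) ≈ᴸ constP (laurent 0 s′) mod[ε^ t ]
  constP-mod t s s′ agree = X , ≈ᴸ-from-≋ ≡.refl coeffs
    where
    open SetoidReasoning setoid
    X : Coeffs n
    X m j = if allZero m then s (j +ℕ t) - s′ (j +ℕ t) else 0#
    coeffs : ∀ m i → (if allZero m then s i else 0#) ≈ (if allZero m then s′ i else 0#) + shift t X m i
    coeffs m i with allZero m | i <ᵇ t in i<t
    ... | true  | true  = trans (agree i (<ᵇ≡true⇒< {i} {t} i<t)) (sym (+-identityʳ _))
    ... | true  | false = begin
      s i                                         ≈⟨ +-identityʳ _ ⟨
      s i + 0#                                    ≈⟨ +-congˡ (-‿inverseˡ (s′ i)) ⟨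
      s i + (- s′ i + s′ i)                       ≈⟨ +-assoc _ _ _ ⟨
      (s i - s′ i) + s′ i                         ≈⟨ +-comm _ _ ⟩
      s′ i + (s i - s′ i)
        ≡⟨ ≡.cong (λ j → s′ i + (s j - s′ j)) (≡.sym (ℕ.m∸n+n≡m (<ᵇ≡false⇒≥ {i} {t} i<t))) ⟩
      s′ i + (s (i ∸ t +ℕ t) - s′ (i ∸ t +ℕ t))   ∎
    ... | false | true  = sym (+-identityʳ 0#)
    ... | false | false = sym (+-identityʳ 0#)

  ≈f+O[ε]-resp-mod-ε : ∀ {x y} {f : Expr Carrier n} → x ≈ᴸ y mod[ε^ 1 ] → (x ≈f+O[ε]) f → (y ≈f+O[ε]) f
  ≈f+O[ε]-resp-mod-ε x≈y x≈f m =
    (λ k → trans (sym (proj₁ (mod-ε¹⇒coeffAt≈ x≈y m) k)) (proj₁ (x≈f m) k)) ,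
    trans (sym (proj₂ (mod-ε¹⇒coeffAt≈ x≈y m))) (proj₂ (x≈f m))

mapConstants : ∀ {a b} {A : Set a} {B : Set b} {k} → (A → B) → Expr A k → Expr B k
mapConstants f (var x)  = var x
mapConstants f (con a)  = con (f a)
mapConstants f (e ⊕ e′) = mapConstants f e ⊕ mapConstants f e′
mapConstants f (e ⊗ e′) = mapConstants f e ⊗ mapConstants f e′

-- If the arguments have poles of order ≤ a, the value of e has poles of order ≤ poleBound e a.
poleBound : ∀ {a} {A : Set a} {k} → Expr A k → ℕ → ℕ
poleBound (var _)  a = a
poleBound (con _)  a = 0
poleBound (e ⊕ e′) a = poleBound e a +ℕ poleBound e′ a
poleBound (e ⊗ e′) a = poleBound e a +ℕ poleBound e′ a

-- If moreover the arguments are known modulo ε^U, the value of e is known modulo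
-- ε^t whenever t + precisionLoss e a ≤ U.
precisionLoss : ∀ {a} {A : Set a} {k} → Expr A k → ℕ → ℕ
precisionLoss (var _)  a = 0
precisionLoss (con _)  a = 0
precisionLoss (e ⊕ e′) a = precisionLoss e a +ℕ precisionLoss e′ a
precisionLoss (e ⊗ e′) a = poleBound (e ⊗ e′) a +ℕ (precisionLoss e a +ℕ precisionLoss e′ a)

poleBound-0 : ∀ {a} {A : Set a} {k} (e : Expr A k) → poleBound e 0 ≡ 0
poleBound-0 (var _)  = ≡.refl
poleBound-0 (con _)  = ≡.refl
poleBound-0 (e ⊕ e′) = ≡.cong₂ _+ℕ_ (poleBound-0 e) (poleBound-0 e′)
poleBound-0 (e ⊗ e′) = ≡.cong₂ _+ℕ_ (poleBound-0 e) (poleBound-0 e′)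

precisionLoss-0 : ∀ {a} {A : Set a} {k} (e : Expr A k) → precisionLoss e 0 ≡ 0
precisionLoss-0 (var _)  = ≡.refl
precisionLoss-0 (con _)  = ≡.refl
precisionLoss-0 (e ⊕ e′) = ≡.cong₂ _+ℕ_ (precisionLoss-0 e) (precisionLoss-0 e′)
precisionLoss-0 (e ⊗ e′) =
  ≡.cong₂ _+ℕ_ (poleBound-0 (e ⊗ e′)) (≡.cong₂ _+ℕ_ (precisionLoss-0 e) (precisionLoss-0 e′))

module Evaluation {c ℓ} (F : Field c ℓ) (n : ℕ) where
  open Field F hiding (zero)
  open WithField F
  open FiniteSums commutativeRing using (sum-map-zero)
  open Approximation F n

  evalE-mapConstants : ∀ {a b} {A : Set a} {B : Set b} (emb : B → Laurent) (f : A → B) (ρ : Fin n → LPoly n) e →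
                       evalE emb ρ (mapConstants f e) ≡ evalE (emb ∘ f) ρ e
  evalE-mapConstants emb f ρ (var x)  = ≡.refl
  evalE-mapConstants emb f ρ (con a)  = ≡.refl
  evalE-mapConstants emb f ρ (e ⊕ e′) = ≡.cong₂ addP (evalE-mapConstants emb f ρ e) (evalE-mapConstants emb f ρ e′)
  evalE-mapConstants emb f ρ (e ⊗ e′) = ≡.cong₂ mulP (evalE-mapConstants emb f ρ e) (evalE-mapConstants emb f ρ e′)

  module _ {A : Set c} where

    evalE-poleOrder≤ : (emb : A → Laurent) → (∀ s → PoleOrder≤ 0 (constP (emb s))) →
      ∀ a (ρ : Fin n → LPoly n) → (∀ i → PoleOrder≤ a (ρ i)) → ∀ e → PoleOrder≤ (poleBound e a) (evalE emb ρ e)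
    evalE-poleOrder≤ emb const-poles a ρ ρ-poles (var i)  = ρ-poles i
    evalE-poleOrder≤ emb const-poles a ρ ρ-poles (con s)  = const-poles s
    evalE-poleOrder≤ emb const-poles a ρ ρ-poles (e ⊕ e′) = poleOrder≤-addP
      (poleOrder≤-weaken (evalE-poleOrder≤ emb const-poles a ρ ρ-poles e) (ℕ.m≤m+n _ _))
      (poleOrder≤-weaken (evalE-poleOrder≤ emb const-poles a ρ ρ-poles e′) (ℕ.m≤n+m _ _))
    evalE-poleOrder≤ emb const-poles a ρ ρ-poles (e ⊗ e′) = poleOrder≤-mulP
      (evalE-poleOrder≤ emb const-poles a ρ ρ-poles e) (evalE-poleOrder≤ emb const-poles a ρ ρ-poles e′)

    module _ (emb₁ emb₂ : A → Laurent)
             (const-poles₁ : ∀ s → PoleOrder≤ 0 (constP (emb₁ s)))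
             (const-poles₂ : ∀ s → PoleOrder≤ 0 (constP (emb₂ s)))
             (U : ℕ) (consts-mod : ∀ s → constP (emb₁ s) ≈ᴸ constP (emb₂ s) mod[ε^ U ])
             (a : ℕ) (ρ₁ ρ₂ : Fin n → LPoly n)
             (ρ₁-poles : ∀ i → PoleOrder≤ a (ρ₁ i)) (ρ₂-poles : ∀ i → PoleOrder≤ a (ρ₂ i))
             (ρ-mod : ∀ i → ρ₁ i ≈ᴸ ρ₂ i mod[ε^ U ])
      where

      evalE-mod : ∀ e t → t +ℕ precisionLoss e a ≤ U → evalE emb₁ ρ₁ e ≈ᴸ evalE emb₂ ρ₂ e mod[ε^ t ]
      evalE-mod (var i)  t t≤U = mod-weaken (ρ-mod i) (ℕ.≤-trans (ℕ.m≤m+n t 0) t≤U)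
      evalE-mod (con s)  t t≤U = mod-weaken (consts-mod s) (ℕ.≤-trans (ℕ.m≤m+n t 0) t≤U)
      evalE-mod (e ⊕ e′) t t≤U = mod-addP
        (evalE-mod e  t (ℕ.≤-trans (ℕ.+-monoʳ-≤ t (ℕ.m≤m+n _ _)) t≤U))
        (evalE-mod e′ t (ℕ.≤-trans (ℕ.+-monoʳ-≤ t (ℕ.m≤n+m _ _)) t≤U))
      evalE-mod (e ⊗ e′) t t≤U = mod-mulP
        (evalE-mod e  (t +ℕ a′) (shifted (ℕ.m≤m+n _ _)))
        (evalE-mod e′ (t +ℕ a′) (shifted (ℕ.m≤n+m _ _)))
        (poleOrder≤-weaken (evalE-poleOrder≤ emb₁ const-poles₁ a ρ₁ ρ₁-poles e) (ℕ.m≤m+n _ _))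
        (poleOrder≤-weaken (evalE-poleOrder≤ emb₂ const-poles₂ a ρ₂ ρ₂-poles e′) (ℕ.m≤n+m _ _))
        where
        a′ = poleBound (e ⊗ e′) a
        shifted : ∀ {l} → l ≤ precisionLoss e a +ℕ precisionLoss e′ a → (t +ℕ a′) +ℕ l ≤ U
        shifted l≤ =
          ℕ.≤-trans (ℕ.≤-reflexive (ℕ.+-assoc t a′ _)) (ℕ.≤-trans (ℕ.+-monoʳ-≤ t (ℕ.+-monoʳ-≤ a′ l≤)) t≤U)

  substPow-agrees : ∀ N (s : Series) i → i < N → Laurent.lco (fromF (s 0)) i ≈ substPow N s i
  substPow-agrees N s zero    _   rewrite ℕ.*-zeroʳ N = sym (+-identityʳ _)
  substPow-agrees N s (suc i) i<N = sym (sum-map-zero (upTo (suc (suc i))) vanish)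
    where
    vanish : ∀ k → (if (N *ℕ k) ≡ᵇ suc i then s k else 0#) ≈ 0#
    vanish zero    rewrite ℕ.*-zeroʳ N = refl
    vanish (suc k) rewrite >⇒≡ᵇ≡false (ℕ.≤-trans i<N (ℕ.m≤m*n N (suc k))) = refl

module OracleReplacement {c ℓ} (F : Field c ℓ) (n : ℕ)
  (g : Expr (Field.Carrier F) n) (h : Expr (WithField.Series F) n) where
  open Field F hiding (zero)
  open WithField F
  open LaurentPolynomials F n using (_≈ᴸ_)
  open Approximation F n
  open Evaluation F n
  open PolynomialIdentity F n using (evalE-cong-coeffs)

  gatePoleBound : ∀ {w} → Gate n w → ℕ → ℕ
  gatePoleBound (constG l)  a = Laurent.lsh l
  gatePoleBound (addG _ _)  a = a
  gatePoleBound (mulG _ _)  a = a +ℕ a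
  gatePoleBound (oracleG _) a = poleBound g a +ℕ poleBound h a

  progPoleBound : ∀ {k} → Prog n k → ℕ
  progPoleBound []       = 0
  progPoleBound (P ▷ gt) = progPoleBound P +ℕ gatePoleBound gt (progPoleBound P)

  progPrecisionLoss : ∀ {k} → Prog n k → ℕ
  progPrecisionLoss []       = 0
  progPrecisionLoss (P ▷ gt) = (progPoleBound P +ℕ precisionLoss h (progPoleBound P)) +ℕ progPrecisionLoss P

  module _ (h≈g : (⟦ h ⟧S ≈f+O[ε]) g) (N : ℕ) where

    private
      h₀ : Expr Carrier n
      h₀ = mapConstants (λ s → s 0) h

      constantTerm : Series → Laurent
      constantTerm s = fromF (s 0)

      h₀≈h : evalE constantTerm varP h ≈ᴸ ⟦ h ⟧S mod[ε^ 1 ]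
      h₀≈h = evalE-mod constantTerm fromSeries (λ _ → poleOrder≤-sh _) (λ _ → poleOrder≤-sh _)
        1 (λ s → constP-mod 1 _ s agree)
        0 varP varP (poleOrder≤-sh ∘ varP) (poleOrder≤-sh ∘ varP) (mod-refl 1 ∘ varP)
        h 1 (ℕ.≤-reflexive (≡.cong suc (precisionLoss-0 h)))
        where
        agree : ∀ {s : Series} i → i < 1 → Laurent.lco (constantTerm s) i ≈ s i
        agree zero    _             = refl
        agree (suc i) (s≤s ())

      g≈h₀ : ∀ ρ → oracleF g ρ ≈ᴸ evalE constantTerm ρ h
      g≈h₀ ρ = ≡.subst (oracleF g ρ ≈ᴸ_) (evalE-mapConstants fromF (λ s → s 0) ρ h)
                       (evalE-cong-coeffs g h₀ same-constant-terms ρ)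
        where
        same-constant-terms : ∀ m → coeffAt ⟦ g ⟧F m (+ 0) ≈ coeffAt ⟦ h₀ ⟧F m (+ 0)
        same-constant-terms m = sym (trans
          (reflexive (≡.cong (λ p → coeffAt p m (+ 0)) (evalE-mapConstants fromF (λ s → s 0) varP h)))
          (trans (proj₂ (mod-ε¹⇒coeffAt≈ h₀≈h m)) (proj₂ (h≈g m))))

    oracle-mod : ∀ a (ρ ρ′ : Fin n → LPoly n) → (∀ i → PoleOrder≤ a (ρ i)) → (∀ i → PoleOrder≤ a (ρ′ i)) →
      ∀ U → (∀ i → ρ i ≈ᴸ ρ′ i mod[ε^ U ]) → U ≤ N →
      ∀ t → t +ℕ precisionLoss h a ≤ U → oracleF g ρ ≈ᴸ oracleSubst h N ρ′ mod[ε^ t ]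
    oracle-mod a ρ ρ′ ρ-poles ρ′-poles U ρ≈ρ′ U≤N t t≤U = mod-respˡ (g≈h₀ ρ)
      (evalE-mod constantTerm (fromSeries ∘ substPow N) (λ _ → poleOrder≤-sh _) (λ _ → poleOrder≤-sh _) U
        (λ s → mod-weaken (constP-mod N _ (substPow N s) (substPow-agrees N s)) U≤N)
        a ρ ρ′ ρ-poles ρ′-poles ρ≈ρ′ h t t≤U)

    private
      Og Oh : Oracle n
      Og = oracleF g
      Oh = oracleSubst h N

    record WiresAgree {k} (P : Prog n k) : Set (c ⊔ ℓ) where
      field
        g-poles : ∀ i → PoleOrder≤ (progPoleBound P) (wires Og P i)
        h-poles : ∀ i → PoleOrder≤ (progPoleBound P) (wires Oh P i)
        wires-mod : ∀ t → t +ℕ progPrecisionLoss P ≤ N → ∀ i → wires Og P i ≈ᴸ wires Oh P i mod[ε^ t ]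

    wiresAgree : ∀ {k} (P : Prog n k) → WiresAgree P
    wiresAgree [] = record
      { g-poles = λ i → poleOrder≤-sh (varP i)
      ; h-poles = λ i → poleOrder≤-sh (varP i)
      ; wires-mod = λ t _ i → mod-refl t (varP i) }
    wiresAgree {suc k} (P ▷ gt) = record
      { g-poles = λ { zero → proj₁ (gate-poles gt) ; (suc i) → poleOrder≤-weaken (g-poles i) (ℕ.m≤m+n A _) }
      ; h-poles = λ { zero → proj₂ (gate-poles gt) ; (suc i) → poleOrder≤-weaken (h-poles i) (ℕ.m≤m+n A _) }
      ; wires-mod = λ { t t≤N zero    → gate-mod gt t (fits {t} t≤N)
                      ; t t≤N (suc i) → wires-mod t (fits {t} t≤N (ℕ.m≤m+n t _)) i } }
      where
      open WiresAgree (wiresAgree P)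
      A = progPoleBound P
      L = precisionLoss h A
      K = progPrecisionLoss P

      fits : ∀ {t t′} → t +ℕ ((A +ℕ L) +ℕ K) ≤ N → t′ ≤ t +ℕ (A +ℕ L) → t′ +ℕ K ≤ N
      fits {t} t≤N t′≤ = ℕ.≤-trans (ℕ.+-monoˡ-≤ K t′≤) (ℕ.≤-trans (ℕ.≤-reflexive (ℕ.+-assoc t (A +ℕ L) K)) t≤N)

      gate-poles : ∀ (gt : Gate n (k +ℕ n)) →
        PoleOrder≤ (A +ℕ gatePoleBound gt A) (evalGate Og (wires Og P) gt) ×
        PoleOrder≤ (A +ℕ gatePoleBound gt A) (evalGate Oh (wires Oh P) gt)
      gate-poles (constG l) =
        poleOrder≤-weaken (poleOrder≤-sh (constP l)) (ℕ.m≤n+m _ A) ,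
        poleOrder≤-weaken (poleOrder≤-sh (constP l)) (ℕ.m≤n+m _ A)
      gate-poles (addG i j) =
        poleOrder≤-weaken (poleOrder≤-addP (g-poles i) (g-poles j)) (ℕ.m≤m+n A A) ,
        poleOrder≤-weaken (poleOrder≤-addP (h-poles i) (h-poles j)) (ℕ.m≤m+n A A)
      gate-poles (mulG i j) =
        poleOrder≤-weaken (poleOrder≤-mulP (g-poles i) (g-poles j)) (ℕ.m≤n+m (A +ℕ A) A) ,
        poleOrder≤-weaken (poleOrder≤-mulP (h-poles i) (h-poles j)) (ℕ.m≤n+m (A +ℕ A) A)
      gate-poles (oracleG σ) =
        poleOrder≤-weaken (evalE-poleOrder≤ fromF (λ _ → poleOrder≤-sh _) A _ (g-poles ∘ σ) g)
          (ℕ.≤-trans (ℕ.m≤m+n (poleBound g A) (poleBound h A)) (ℕ.m≤n+m _ A)) ,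
        poleOrder≤-weaken (evalE-poleOrder≤ (fromSeries ∘ substPow N) (λ _ → poleOrder≤-sh _) A _ (h-poles ∘ σ) h)
          (ℕ.≤-trans (ℕ.m≤n+m (poleBound h A) (poleBound g A)) (ℕ.m≤n+m _ A))

      gate-mod : ∀ (gt : Gate n (k +ℕ n)) t → (∀ {t′} → t′ ≤ t +ℕ (A +ℕ L) → t′ +ℕ K ≤ N) →
                 evalGate Og (wires Og P) gt ≈ᴸ evalGate Oh (wires Oh P) gt mod[ε^ t ]
      gate-mod (constG l)  t fits′ = mod-refl t (constP l)
      gate-mod (addG i j)  t fits′ =
        mod-addP (wires-mod t (fits′ (ℕ.m≤m+n t _)) i) (wires-mod t (fits′ (ℕ.m≤m+n t _)) j)
      gate-mod (mulG i j)  t fits′ =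
        mod-mulP (wires-mod (t +ℕ A) t+A-fits i) (wires-mod (t +ℕ A) t+A-fits j) (g-poles i) (h-poles j)
        where t+A-fits = fits′ (ℕ.+-monoʳ-≤ t (ℕ.m≤m+n A L))
      gate-mod (oracleG σ) t fits′ = oracle-mod A _ _ (g-poles ∘ σ) (h-poles ∘ σ) (t +ℕ L)
          (λ i → wires-mod (t +ℕ L) t+L-fits (σ i)) (ℕ.≤-trans (ℕ.m≤m+n (t +ℕ L) K) t+L-fits) t ℕ.≤-refl
        where t+L-fits = fits′ (ℕ.+-monoʳ-≤ t (ℕ.m≤n+m L A))

lemma2p3 : {c ℓ : Level} (F : Field c ℓ) (n s : ℕ)
    (f g : Expr (Field.Carrier F) n)
    → Σ (WithField.Circuit F n s)
        (λ C → WithField._≈f+O[ε] F (WithField.run F (WithField.oracleF F g) C) f)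
    → (h : Expr (WithField.Series F) n)
    → WithField._≈f+O[ε] F (WithField.⟦_⟧S F h) g
    → Σ ℕ (λ N → 1 ≤ N × Σ (WithField.Circuit F n s)
        (λ C′ → WithField._≈f+O[ε] F (WithField.run F (WithField.oracleSubst F h N) C′) f))
lemma2p3 F n s f g (C , C≈f) h h≈g = suc K , s≤s z≤n , C , ≈f+O[ε]-resp-mod-ε {f = f} output-mod C≈f
  where
  open WithField F using (module Circuit; run; oracleF; oracleSubst)
  open Approximation F n using (_≈ᴸ_mod[ε^_]; ≈f+O[ε]-resp-mod-ε)
  open OracleReplacement F n g h
  K = progPrecisionLoss (Circuit.prog C)
  output-mod : run (oracleF g) C ≈ᴸ run (oracleSubst h (suc K)) C mod[ε^ 1 ]
  output-mod = WiresAgree.wires-mod (wiresAgree h≈g (suc K) (Circuit.prog C)) 1 ℕ.≤-refl (Circuit.output C)
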